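{- For every $n\ge2$ there exist nonnegative integers $c_{n,k}$ ($2\le 2k\le n$) such that $$\sum_{\sigma\in\mathfrak S_n'}\alpha V(\sigma)=\sum_{2\le 2k\le n}c_{n,k}\,(\bar d\,\bar m)^k\,(d+m)^{n-2k}$$ in the commutative polynomial ring $\mathbb Z[m,\bar m,d,\bar d]$.
   Context: $\mathfrak S_n'=\{\sigma\in\mathfrak S_n:\sigma(1)=n\}$, where $\mathfrak S_n$ is the symmetric group on $[n]=\{1,\dots,n\}$. For $\sigma\in\mathfrak S_n'$, set $\sigma(n+1)=\sigma(1)=n$ and define the word $V(\sigma)=v_1v_2\cdots v_n$ over the alphabet $\{m,\bar m,d,\bar d\}$ by: (1) for $j\in[n]$, $v_j\in\{d,\bar d\}$ if $\sigma(j)>\sigma(j+1)$ and $v_j\in\{m,\bar m\}$ if $\sigma(j)<\sigma(j+1)$; (2) if $v_j\in\{d,\bar d\}$ with $j\in[n-1]$, then $v_j=d$ if $v_{j+1}\in\{d,\bar d\}$ and $v_j=\bar d$ if $v_{j+1}\in\{m,\bar m\}$; (3) if $v_j\in\{m,\bar m\}$ with $2\le j\le n$, then $v_j=m$ if $v_{j-1}\in\{m,\bar m\}$ and $v_j=\bar m$ if $v_{j-1}\in\{d,\bar d\}$. (Always $v_1\in\{d,\bar d\}$, $v_n\in\{m,\bar m\}$.) $\alpha$ maps a word to the corresponding commutative monomial. -}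

module Defs where

open import Data.Nat using (ℕ; zero; suc; _+_; _∸_; _<ᵇ_; _/_)
import Data.Nat as ℕ
open import Data.Integer as ℤ using (ℤ; +_)
open import Data.Bool using (Bool; true; false; if_then_else_)
import Data.Bool
open import Data.Maybe using (Maybe; just; nothing)
open import Data.List using (List; []; _∷_; _++_; map; concatMap; filter; foldr; length)
open import Data.List.Relation.Unary.Unique.DecPropositional ℕ._≟_ using (unique?)
open import Data.Product using (_×_; _,_)
open import Data.Product.Properties using (≡-dec)
open import Relation.Binary.PropositionalEquality using (_≡_)
open import Relation.Nullary using (does)

-- Permutations of [n] = {1,…,n}, as one-line words σ(1)σ(2)…σ(n)

range1 : ℕ → List ℕ
range1 zero    = []
range1 (suc n) = range1 n ++ (suc n ∷ [])

words : ℕ → ℕ → List (List ℕ)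
words n zero    = [] ∷ []
words n (suc k) = concatMap (λ x → map (x ∷_) (words n k)) (range1 n)

perms : ℕ → List (List ℕ)
perms n = filter (λ w → unique? w) (words n n)

headIs : ℕ → List ℕ → Bool
headIs n []      = false
headIs n (x ∷ _) = does (n ℕ.≟ x)

perms' : ℕ → List (List ℕ)
perms' n = filter (λ σ → headIs n σ Data.Bool.≟ true) (perms n)

data Letter : Set where
  m m̄ d d̄ : Letter

-- cyclic descent indicators: t_j = (σ(j) > σ(j+1)), with σ(n+1) = σ(1)
descents : List ℕ → List Bool
descents []        = []
descents (s₁ ∷ ss) = go s₁ (s₁ ∷ ss)
  where
  go : ℕ → List ℕ → List Bool
  go first []           = []
  go first (x ∷ [])     = (first <ᵇ x) ∷ []
  go first (x ∷ y ∷ xs) = (y <ᵇ x) ∷ go first (y ∷ xs)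

nextOf : List Bool → Maybe Bool
nextOf []      = nothing
nextOf (t ∷ _) = just t

-- letter v_j from t_{j-1} (nothing if j = 1), t_j, t_{j+1} (nothing if j = n).
-- The 'nothing' cases never occur for σ ∈ 𝔖'_n (v_1 is of type d, v_n of type m).
letter : Maybe Bool → Bool → Maybe Bool → Letter
letter prev true  (just true)  = d
letter prev true  (just false) = d̄
letter prev true  nothing      = d̄
letter (just false) false next = m
letter (just true)  false next = m̄
letter nothing      false next = m̄

vword : Maybe Bool → List Bool → List Letter
vword prev []       = []
vword prev (t ∷ ts) = letter prev t (nextOf ts) ∷ vword (just t) ts

V : List ℕ → List Letter
V σ = vword nothing (descents σ)

-- monomial m^a m̄^b d^c d̄^e  ↦  (a , b , c , e)
Mono : Set
Mono = ℕ × ℕ × ℕ × ℕ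

_≟M_ : (x y : Mono) → Relation.Nullary.Dec (x ≡ y)
_≟M_ = ≡-dec ℕ._≟_ (≡-dec ℕ._≟_ (≡-dec ℕ._≟_ ℕ._≟_))

_*M_ : Mono → Mono → Mono
(a , b , c , e) *M (a' , b' , c' , e') = (a + a' , b + b' , c + c' , e + e')

oneM : Mono
oneM = (0 , 0 , 0 , 0)

-- a polynomial is a finite formal sum of terms (coefficient, monomial)
Poly : Set
Poly = List (ℤ × Mono)

coeff : Poly → Mono → ℤ
coeff []             μ = + 0
coeff ((c , ν) ∷ p) μ = (if does (ν ≟M μ) then c else + 0) ℤ.+ coeff p μ

_≈P_ : Poly → Poly → Set
p ≈P q = ∀ μ → coeff p μ ≡ coeff q μ

0P 1P : Poly
0P = []
1P = (+ 1 , oneM) ∷ []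

_+P_ : Poly → Poly → Poly
p +P q = p ++ q

_*P_ : Poly → Poly → Poly
p *P q = concatMap (λ { (c , μ) → map (λ { (c' , ν) → (c ℤ.* c' , μ *M ν) }) q }) p

_^P_ : Poly → ℕ → Poly
p ^P zero  = 1P
p ^P suc k = p *P (p ^P k)

scal : ℤ → Poly → Poly
scal c p = ((c , oneM) ∷ []) *P p

var : Letter → Poly
var m  = (+ 1 , (1 , 0 , 0 , 0)) ∷ []
var m̄  = (+ 1 , (0 , 1 , 0 , 0)) ∷ []
var d  = (+ 1 , (0 , 0 , 1 , 0)) ∷ []
var d̄  = (+ 1 , (0 , 0 , 0 , 1)) ∷ []

α : List Letter → Poly
α []       = 1P
α (x ∷ xs) = var x *P α xs

sumP : List Poly → Poly
sumP = foldr _+P_ 0P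

lhs : ℕ → Poly
lhs n = sumP (map (λ σ → α (V σ)) (perms' n))

-- right-hand side:  Σ_{2 ≤ 2k ≤ n} c_k (d̄ m̄)^k (d + m)^{n - 2k},
-- i.e. k ranges over 1, …, ⌊n/2⌋
rhs : ℕ → (ℕ → ℕ) → Poly
rhs n c = sumP (map (λ k → scal (+ c k) (((var d̄ *P var m̄) ^P k) *P ((var d +P var m) ^P (n ∸ (k + k)))))
                    (range1 (n / 2)))

-- A permutation in 𝔖′ₙ₊₁ is n + 1 followed by a permutation of [n], and every permutation of [n] arises
-- exactly once by inserting n into a permutation of [n - 1]. Since α V(σ) only depends on the pattern of
-- descents, inserting the maximum into one of the n gaps performs one of the substitutions m̄ → m̄d,
-- m̄ → m̄m, m → m̄d̄, d → m̄d̄ on α V(σ), and over all gaps every m̄ undergoes each of the first two once,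
-- every m and every d the one for its letter once. Hence lhs (n + 1) = D (lhs n) for the derivation with
-- D m = D d = d̄m̄, D m̄ = m̄(d + m), D d̄ = 0, starting from lhs 2 = d̄m̄. For u = d̄m̄ and v = d + m we get
-- D u = uv and D v = 2u, so lhs n is a combination of the u^k v^(n-2k) with coefficients in ℕ.
-- The proof compares coefficients: those of the left-hand side satisfy the coefficient form of P ↦ D P,
-- and so does the closed form [e = b] γ(b, a + c) binom(a, c) at m^a m̄^b d^c d̄^e, which is also the
-- coefficient of the right-hand side.

module Submission where

open import Defs
open import Data.Nat using (ℕ; _≥_)
open import Data.Product using (Σ)

open import Data.Bool as Bool using (Bool; true; false; if_then_else_; _∧_)
import Data.Bool.Properties as Bool
open import Data.Empty using (⊥)
open import Data.Integer as ℤ using (ℤ)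
import Data.Integer.Properties as ℤ
open import Data.List using (List; []; _∷_; _++_; [_]; map; concatMap; filter; length)
import Data.List.Properties as List
open import Data.List.Membership.Propositional using (_∈_)
open import Data.List.Membership.Propositional.Properties using (∈-++⁺ˡ; ∈-++⁺ʳ)
open import Data.List.Relation.Unary.All as All using (All; []; _∷_; all?)
import Data.List.Relation.Unary.All.Properties as All
open import Data.List.Relation.Unary.AllPairs using ([]; _∷_)
import Data.List.Relation.Unary.AllPairs.Properties as AllPairs
open import Data.List.Relation.Unary.Any using (here; there)
open import Data.List.Relation.Unary.Unique.Propositional using (Unique)
import Data.List.Relation.Unary.Unique.Propositional.Properties as Unique
open import Data.Maybe using (Maybe; just; nothing; maybe)
open import Data.Nat as ℕ using (zero; suc; _+_; _*_; _∸_; _<_; _≤_; _<ᵇ_; _/_; s≤s; z≤n)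
import Data.Nat.DivMod as DivMod
import Data.Nat.Properties as ℕ
open import Data.Nat.Tactic.RingSolver using (solve-∀)
open import Data.List.Relation.Unary.Unique.DecPropositional ℕ._≟_ using (unique?)
open import Algebra.Properties.CommutativeSemigroup ℕ.+-commutativeSemigroup
  using () renaming (interchange to +-interchange)
open import Data.Product using (_×_; _,_; proj₁; proj₂)
open import Data.Product.Properties using (≡-dec)
open import Function using (_⇔_; mk⇔; Equivalence; id)
open import Level using (0ℓ)
open import Relation.Binary.PropositionalEquality
  using (_≡_; _≢_; refl; sym; trans; cong; cong₂; subst; ≢-sym; module ≡-Reasoning)
open import Relation.Nullary using (Dec; yes; no; does; ¬_; ¬?; contradiction; _×-dec_)
open import Relation.Nullary.Decidable using (dec-true; dec-false; does-⇔)
open import Relation.Unary using (Pred; Decidable)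

-- Guards and sums over lists

when : Bool → ℕ → ℕ
when b v = if b then v else 0

when-zero : ∀ b → when b 0 ≡ 0
when-zero true  = refl
when-zero false = refl

when-+ : ∀ b u v → when b (u + v) ≡ when b u + when b v
when-+ true  u v = refl
when-+ false u v = refl

*-when : ∀ c b v → c * when b v ≡ when b (c * v)
*-when c true  v = refl
*-when c false v = ℕ.*-zeroʳ c

when-∧ : ∀ a b v → when (a ∧ b) v ≡ when a (when b v)
when-∧ true  b v = refl
when-∧ false b v = refl

module _ {P : Set} where

  when-yes : (P? : Dec P) → ∀ {v} → P → when (does P?) v ≡ v
  when-yes P? p = cong (λ b → when b _) (dec-true P? p)

  when-no : (P? : Dec P) → ∀ {v} → ¬ P → when (does P?) v ≡ 0
  when-no P? ¬p = cong (λ b → when b _) (dec-false P? ¬p)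

  when-cong : (P? : Dec P) → ∀ {u v} → (P → u ≡ v) → when (does P?) u ≡ when (does P?) v
  when-cong (yes p) eq = eq p
  when-cong (no _)  eq = refl

when-⇔ : ∀ {P Q : Set} (P? : Dec P) (Q? : Dec Q) {u v} → P ⇔ Q → (P → u ≡ v) → when (does P?) u ≡ when (does Q?) v
when-⇔ P? Q? {v = v} P⇔Q eq = trans (when-cong P? eq) (cong (λ b → when b v) (does-⇔ P⇔Q P? Q?))

∑ : {A : Set} → List A → (A → ℕ) → ℕ
∑ []       f = 0
∑ (x ∷ xs) f = f x + ∑ xs f

module _ {A : Set} where

  ∑-++ : ∀ xs ys (f : A → ℕ) → ∑ (xs ++ ys) f ≡ ∑ xs f + ∑ ys f
  ∑-++ []       ys f = refl
  ∑-++ (x ∷ xs) ys f = trans (cong (f x +_) (∑-++ xs ys f)) (sym (ℕ.+-assoc (f x) _ _))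

  ∑-cong-∈ : ∀ xs {f g : A → ℕ} → (∀ {x} → x ∈ xs → f x ≡ g x) → ∑ xs f ≡ ∑ xs g
  ∑-cong-∈ []       eq = refl
  ∑-cong-∈ (x ∷ xs) eq = cong₂ _+_ (eq (here refl)) (∑-cong-∈ xs (λ p → eq (there p)))

  ∑-cong : ∀ xs {f g : A → ℕ} → (∀ x → f x ≡ g x) → ∑ xs f ≡ ∑ xs g
  ∑-cong xs eq = ∑-cong-∈ xs (λ {x} _ → eq x)

  ∑-+ : ∀ xs (f g : A → ℕ) → ∑ xs (λ x → f x + g x) ≡ ∑ xs f + ∑ xs g
  ∑-+ []       f g = refl
  ∑-+ (x ∷ xs) f g = trans (cong (f x + g x +_) (∑-+ xs f g)) (+-interchange (f x) (g x) _ _)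

  ∑-* : ∀ xs c (f : A → ℕ) → ∑ xs (λ x → c * f x) ≡ c * ∑ xs f
  ∑-* []       c f = sym (ℕ.*-zeroʳ c)
  ∑-* (x ∷ xs) c f = trans (cong (c * f x +_) (∑-* xs c f)) (sym (ℕ.*-distribˡ-+ c (f x) _))

  ∑-zero : ∀ xs → ∑ {A} xs (λ _ → 0) ≡ 0
  ∑-zero []       = refl
  ∑-zero (x ∷ xs) = ∑-zero xs

  ∑-when : ∀ xs b (f : A → ℕ) → ∑ xs (λ x → when b (f x)) ≡ when b (∑ xs f)
  ∑-when xs true  f = refl
  ∑-when xs false f = ∑-zero xs

  ∑-filter : {P : Pred A 0ℓ} (P? : Decidable P) → ∀ xs (f : A → ℕ) →
             ∑ (filter P? xs) f ≡ ∑ xs (λ x → when (does (P? x)) (f x))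
  ∑-filter P? []       f = refl
  ∑-filter P? (x ∷ xs) f with does (P? x)
  ... | true  = cong (f x +_) (∑-filter P? xs f)
  ... | false = ∑-filter P? xs f

module _ {A B : Set} where

  ∑-map : ∀ (g : A → B) xs (f : B → ℕ) → ∑ (map g xs) f ≡ ∑ xs (λ x → f (g x))
  ∑-map g []       f = refl
  ∑-map g (x ∷ xs) f = cong (f (g x) +_) (∑-map g xs f)

  ∑-concatMap : ∀ (g : A → List B) xs (f : B → ℕ) → ∑ (concatMap g xs) f ≡ ∑ xs (λ x → ∑ (g x) f)
  ∑-concatMap g []       f = refl
  ∑-concatMap g (x ∷ xs) f = trans (∑-++ (g x) _ f) (cong (∑ (g x) f +_) (∑-concatMap g xs f))

  ∑-comm : ∀ xs ys (f : A → B → ℕ) → ∑ xs (λ x → ∑ ys (f x)) ≡ ∑ ys (λ y → ∑ xs (λ x → f x y))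
  ∑-comm []       ys f = sym (∑-zero ys)
  ∑-comm (x ∷ xs) ys f = trans (cong (∑ ys (f x) +_) (∑-comm xs ys f)) (sym (∑-+ ys (f x) _))

module _ {B : ℕ} (F : ℕ → ℕ) where

  ∑-pick-∉ : ∀ xs → (∀ {k} → k ∈ xs → B ≢ k) → ∑ xs (λ k → when (does (B ℕ.≟ k)) (F k)) ≡ 0
  ∑-pick-∉ xs B∉xs = trans (∑-cong-∈ xs (λ k∈xs → when-no (B ℕ.≟ _) (B∉xs k∈xs))) (∑-zero xs)

  ∑-pick-∈ : ∀ {xs} → B ∈ xs → Unique xs → ∑ xs (λ k → when (does (B ℕ.≟ k)) (F k)) ≡ F B
  ∑-pick-∈ (here refl) (B∉xs ∷ _) =
    trans (cong₂ _+_ (when-yes (B ℕ.≟ B) refl) (∑-pick-∉ _ (All.lookup B∉xs))) (ℕ.+-identityʳ (F B))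
  ∑-pick-∈ (there B∈xs) (y∉xs ∷ uxs) =
    cong₂ _+_ (when-no (B ℕ.≟ _) (λ { refl → All.lookup y∉xs B∈xs refl })) (∑-pick-∈ B∈xs uxs)

-- Words and injective words

wordsOver : {A : Set} → List A → ℕ → List (List A)
wordsOver S zero    = [] ∷ []
wordsOver S (suc k) = concatMap (λ x → map (x ∷_) (wordsOver S k)) S

words≡wordsOver : ∀ n k → words n k ≡ wordsOver (range1 n) k
words≡wordsOver n zero    = refl
words≡wordsOver n (suc k) = cong (λ W → concatMap (λ x → map (x ∷_) W) (range1 n)) (words≡wordsOver n k)

module _ {A : Set} where

  ∑-wordsOver-suc : ∀ (S : List A) k f → ∑ (wordsOver S (suc k)) f ≡ ∑ S (λ x → ∑ (wordsOver S k) (λ w → f (x ∷ w)))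
  ∑-wordsOver-suc S k f = trans (∑-concatMap _ S f) (∑-cong S (λ x → ∑-map (x ∷_) (wordsOver S k) f))

  ∑-wordsOver-cong : ∀ (S : List A) k {f g : List A → ℕ} →
                     (∀ {w} → length w ≡ k → All (_∈ S) w → f w ≡ g w) → ∑ (wordsOver S k) f ≡ ∑ (wordsOver S k) g
  ∑-wordsOver-cong S zero    eq = cong (_+ 0) (eq refl [])
  ∑-wordsOver-cong S (suc k) {f} {g} eq = begin
      ∑ (wordsOver S (suc k)) f
    ≡⟨ ∑-wordsOver-suc S k f ⟩
      ∑ S (λ x → ∑ (wordsOver S k) (λ w → f (x ∷ w)))
    ≡⟨ ∑-cong-∈ S (λ x∈S → ∑-wordsOver-cong S k (λ len w⊆S → eq (cong suc len) (x∈S ∷ w⊆S))) ⟩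
      ∑ S (λ x → ∑ (wordsOver S k) (λ w → g (x ∷ w)))
    ≡⟨ ∑-wordsOver-suc S k g ⟨
      ∑ (wordsOver S (suc k)) g
    ∎
    where open ≡-Reasoning

  ∑-wordsOver-all : {P : Pred A 0ℓ} (P? : Decidable P) → ∀ S k (f : List A → ℕ) →
                    ∑ (wordsOver S k) (λ w → when (does (all? P? w)) (f w)) ≡ ∑ (wordsOver (filter P? S) k) f
  ∑-wordsOver-all P? S zero    f = refl
  ∑-wordsOver-all P? S (suc k) f = begin
      ∑ (wordsOver S (suc k)) (λ w → when (does (all? P? w)) (f w))
    ≡⟨ ∑-wordsOver-suc S k _ ⟩
      ∑ S (λ x → ∑ (wordsOver S k) (λ w → when (does (P? x) ∧ does (all? P? w)) (f (x ∷ w))))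
    ≡⟨ ∑-cong S (λ x → trans (∑-cong (wordsOver S k) (λ w → when-∧ (does (P? x)) (does (all? P? w)) (f (x ∷ w))))
                               (∑-when (wordsOver S k) (does (P? x)) _)) ⟩
      ∑ S (λ x → when (does (P? x)) (∑ (wordsOver S k) (λ w → when (does (all? P? w)) (f (x ∷ w)))))
    ≡⟨ ∑-cong S (λ x → cong (when (does (P? x))) (∑-wordsOver-all P? S k _)) ⟩
      ∑ S (λ x → when (does (P? x)) (∑ (wordsOver (filter P? S) k) (λ w → f (x ∷ w))))
    ≡⟨ ∑-filter P? S _ ⟨
      ∑ (filter P? S) (λ x → ∑ (wordsOver (filter P? S) k) (λ w → f (x ∷ w)))
    ≡⟨ ∑-wordsOver-suc (filter P? S) k f ⟨
      ∑ (wordsOver (filter P? S) (suc k)) f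
    ∎
    where open ≡-Reasoning

distinct : List ℕ → Bool
distinct w = does (unique? w)

∑Inj : List ℕ → ℕ → (List ℕ → ℕ) → ℕ
∑Inj S k g = ∑ (wordsOver S k) (λ w → when (distinct w) (g w))

_≢?_ : (x y : ℕ) → Dec (x ≢ y)
x ≢? y = ¬? (x ℕ.≟ y)

remove : ℕ → List ℕ → List ℕ
remove x = filter (x ≢?_)

∑Inj-suc : ∀ S k g → ∑Inj S (suc k) g ≡ ∑ S (λ x → ∑Inj (remove x S) k (λ w → g (x ∷ w)))
∑Inj-suc S k g = trans (∑-wordsOver-suc S k _) (∑-cong S (λ x →
  trans (∑-cong (wordsOver S k) (λ w → when-∧ (does (all? (x ≢?_) w)) (distinct w) (g (x ∷ w))))
        (∑-wordsOver-all (x ≢?_) S k _)))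

module _ (S : List ℕ) (k : ℕ) where

  ∑Inj-cong : {f g : List ℕ → ℕ} → (∀ w → f w ≡ g w) → ∑Inj S k f ≡ ∑Inj S k g
  ∑Inj-cong eq = ∑-cong (wordsOver S k) (λ w → cong (when (distinct w)) (eq w))

  ∑Inj-cong-words : {f g : List ℕ → ℕ} → (∀ {w} → length w ≡ k → All (_∈ S) w → f w ≡ g w) → ∑Inj S k f ≡ ∑Inj S k g
  ∑Inj-cong-words eq = ∑-wordsOver-cong S k (λ len w⊆S → cong (when _) (eq len w⊆S))

  ∑Inj-+ : ∀ f g → ∑Inj S k (λ w → f w + g w) ≡ ∑Inj S k f + ∑Inj S k g
  ∑Inj-+ f g = trans (∑-cong (wordsOver S k) (λ w → when-+ (distinct w) _ _)) (∑-+ (wordsOver S k) _ _)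

  ∑Inj-* : ∀ c f → ∑Inj S k (λ w → c * f w) ≡ c * ∑Inj S k f
  ∑Inj-* c f = trans (∑-cong (wordsOver S k) (λ w → sym (*-when c (distinct w) (f w)))) (∑-* (wordsOver S k) c _)

  ∑Inj-zero : ∑Inj S k (λ _ → 0) ≡ 0
  ∑Inj-zero = trans (∑-cong (wordsOver S k) (λ w → when-zero (distinct w))) (∑-zero (wordsOver S k))

  ∑Inj-∑ : {B : Set} (ys : List B) (f : List ℕ → B → ℕ) →
           ∑Inj S k (λ w → ∑ ys (f w)) ≡ ∑ ys (λ y → ∑Inj S k (λ w → f w y))
  ∑Inj-∑ ys f = trans (∑-cong (wordsOver S k) (λ w → sym (∑-when ys (distinct w) (f w)))) (∑-comm (wordsOver S k) ys _)

module _ {x M : ℕ} where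

  remove-snoc-≢ : ∀ S → x ≢ M → remove x (S ++ [ M ]) ≡ remove x S ++ [ M ]
  remove-snoc-≢ S x≢M = trans (List.filter-++ (x ≢?_) S [ M ]) (cong (remove x S ++_) (List.filter-accept (x ≢?_) x≢M))

remove-snoc-self : ∀ {M S} → All (M ≢_) S → remove M (S ++ [ M ]) ≡ S
remove-snoc-self {M} {S} M∉S = begin
  remove M (S ++ [ M ])          ≡⟨ List.filter-++ (M ≢?_) S [ M ] ⟩
  remove M S ++ remove M [ M ]   ≡⟨ cong₂ _++_ (List.filter-all (M ≢?_) M∉S)
                                               (List.filter-reject (M ≢?_) (λ M≢M → M≢M refl)) ⟩
  S ++ []                        ≡⟨ List.++-identityʳ S ⟩
  S                              ∎
  where open ≡-Reasoning

length-remove : ∀ {x S} → x ∈ S → Unique S → suc (length (remove x S)) ≡ length S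
length-remove {x} (here refl) (x∉S ∷ _) =
  cong (λ l → suc (length l)) (trans (List.filter-reject (x ≢?_) (λ x≢x → x≢x refl)) (List.filter-all (x ≢?_) x∉S))
length-remove {x} (there x∈S) (y∉S ∷ uS) =
  trans (cong (λ l → suc (length l)) (List.filter-accept (x ≢?_) (λ x≡y → All.lookup y∉S x∈S (sym x≡y))))
        (cong suc (length-remove x∈S uS))

insertions : {A : Set} → A → List A → List (List A)
insertions M []      = (M ∷ []) ∷ []
insertions M (x ∷ w) = (M ∷ x ∷ w) ∷ map (x ∷_) (insertions M w)

∑Inj-snoc : ∀ M k S → length S ≡ k → All (M ≢_) S → Unique S → ∀ g →
            ∑Inj (S ++ [ M ]) (suc k) g ≡ ∑Inj S k (λ w → ∑ (insertions M w) g)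
∑Inj-snoc M zero    []      _ _   _  g = sym (ℕ.+-identityʳ _)
∑Inj-snoc M (suc k) S       len M∉S uS g = begin
    ∑Inj (S ++ [ M ]) (suc (suc k)) g
  ≡⟨ ∑Inj-suc (S ++ [ M ]) (suc k) g ⟩
    ∑ (S ++ [ M ]) (λ x → ∑Inj (remove x (S ++ [ M ])) (suc k) (λ w → g (x ∷ w)))
  ≡⟨ ∑-++ S [ M ] _ ⟩
    ∑ S (λ x → ∑Inj (remove x (S ++ [ M ])) (suc k) (λ w → g (x ∷ w)))
      + (∑Inj (remove M (S ++ [ M ])) (suc k) (λ w → g (M ∷ w)) + 0)
  ≡⟨ cong₂ _+_ (∑-cong-∈ S insertLater) (trans (ℕ.+-identityʳ _) insertFirst) ⟩
    later + front
  ≡⟨ ℕ.+-comm later front ⟩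
    front + later
  ≡⟨ ∑-+ S _ _ ⟨
    ∑ S (λ x → ∑Inj (remove x S) k (λ w → g (M ∷ x ∷ w))
               + ∑Inj (remove x S) k (λ w → ∑ (insertions M w) (λ v → g (x ∷ v))))
  ≡⟨ ∑-cong S (λ x → trans (sym (∑Inj-+ (remove x S) k _ _))
                           (∑Inj-cong (remove x S) k (λ w → cong (g (M ∷ x ∷ w) +_)
                                                                 (sym (∑-map (x ∷_) (insertions M w) g))))) ⟩
    ∑ S (λ x → ∑Inj (remove x S) k (λ w → ∑ (insertions M (x ∷ w)) g))
  ≡⟨ ∑Inj-suc S k _ ⟨
    ∑Inj S (suc k) (λ w → ∑ (insertions M w) g)
  ∎
  where
  open ≡-Reasoning
  front later : ℕ
  front = ∑ S (λ x → ∑Inj (remove x S) k (λ w → g (M ∷ x ∷ w)))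
  later = ∑ S (λ x → ∑Inj (remove x S) k (λ w → ∑ (insertions M w) (λ v → g (x ∷ v))))
  insertFirst : ∑Inj (remove M (S ++ [ M ])) (suc k) (λ w → g (M ∷ w)) ≡ front
  insertFirst = trans (cong (λ T → ∑Inj T (suc k) (λ w → g (M ∷ w))) (remove-snoc-self M∉S)) (∑Inj-suc S k _)
  insertLater : ∀ {x} → x ∈ S → ∑Inj (remove x (S ++ [ M ])) (suc k) (λ w → g (x ∷ w))
                                ≡ ∑Inj (remove x S) k (λ w → ∑ (insertions M w) (λ v → g (x ∷ v)))
  insertLater x∈S =
    trans (cong (λ T → ∑Inj T (suc k) (λ w → g (_ ∷ w))) (remove-snoc-≢ S (λ x≡M → All.lookup M∉S x∈S (sym x≡M))))
          (∑Inj-snoc M k (remove _ S) (ℕ.suc-injective (trans (length-remove x∈S uS) len))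
                     (All.filter⁺ (_ ≢?_) M∉S) (Unique.filter⁺ (_ ≢?_) uS) _)

range1-< : ∀ n → All (_< suc n) (range1 n)
range1-< zero    = []
range1-< (suc n) = All.++⁺ (All.map ℕ.m<n⇒m<1+n (range1-< n)) (ℕ.≤-refl ∷ [])

range1-positive : ∀ n → All (0 <_) (range1 n)
range1-positive zero    = []
range1-positive (suc n) = All.++⁺ (range1-positive n) (s≤s z≤n ∷ [])

length-range1 : ∀ n → length (range1 n) ≡ n
length-range1 zero    = refl
length-range1 (suc n) = trans (List.length-++ (range1 n)) (trans (ℕ.+-comm _ 1) (cong suc (length-range1 n)))

unique-range1 : ∀ n → Unique (range1 n)
unique-range1 zero    = []
unique-range1 (suc n) = AllPairs.++⁺ (unique-range1 n) ([] ∷ []) (All.map (λ x<n → ℕ.<⇒≢ x<n ∷ []) (range1-< n))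

top∉range1 : ∀ n → All (suc n ≢_) (range1 n)
top∉range1 n = All.map (λ x<1+n → ≢-sym (ℕ.<⇒≢ x<1+n)) (range1-< n)

∈-range1 : ∀ {n x} → 0 < x → x ≤ n → x ∈ range1 n
∈-range1 {zero}  {suc x} _ ()
∈-range1 {suc n} {x} 0<x x≤1+n with x ℕ.≟ suc n
... | yes refl = ∈-++⁺ʳ (range1 n) (here refl)
... | no  x≢   = ∈-++⁺ˡ (∈-range1 0<x (ℕ.≤-pred (ℕ.≤∧≢⇒< x≤1+n x≢)))

∑-perms' : ∀ L (f : List ℕ → ℕ) → ∑ (perms' (suc L)) f ≡ ∑Inj (range1 L) L (λ w → f (suc L ∷ w))
∑-perms' L f = begin
    ∑ (perms' n) f
  ≡⟨ ∑-filter (λ σ → headIs n σ Bool.≟ true) (perms n) f ⟩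
    ∑ (perms n) (λ σ → when (isTop σ) (f σ))
  ≡⟨ ∑-filter unique? (words n n) _ ⟩
    ∑ (words n n) (λ σ → when (distinct σ) (when (isTop σ) (f σ)))
  ≡⟨ cong (λ W → ∑ W (λ σ → when (distinct σ) (when (isTop σ) (f σ)))) (words≡wordsOver n n) ⟩
    ∑Inj (range1 L ++ [ n ]) n (λ σ → when (isTop σ) (f σ))
  ≡⟨ ∑Inj-suc (range1 L ++ [ n ]) L _ ⟩
    ∑ (range1 L ++ [ n ]) (λ x → ∑Inj (remove x (range1 L ++ [ n ])) L (λ w → when (isTop (x ∷ w)) (f (x ∷ w))))
  ≡⟨ ∑-++ (range1 L) [ n ] _ ⟩
    ∑ (range1 L) (λ x → ∑Inj (remove x (range1 L ++ [ n ])) L (λ w → when (isTop (x ∷ w)) (f (x ∷ w))))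
      + (∑Inj (remove n (range1 L ++ [ n ])) L (λ w → when (isTop (n ∷ w)) (f (n ∷ w))) + 0)
  ≡⟨ cong₂ _+_ (trans (∑-cong-∈ (range1 L) lowerHead) (∑-zero (range1 L))) (trans (ℕ.+-identityʳ _) topHead) ⟩
    ∑Inj (range1 L) L (λ w → f (n ∷ w))
  ∎
  where
  open ≡-Reasoning
  n = suc L
  isTop : List ℕ → Bool
  isTop σ = does (headIs n σ Bool.≟ true)
  lowerHead : ∀ {x} → x ∈ range1 L → ∑Inj (remove x (range1 L ++ [ n ])) L (λ w → when (isTop (x ∷ w)) (f (x ∷ w))) ≡ 0
  lowerHead {x} x∈ = trans (∑Inj-cong _ L (λ w → cong (λ b → when (does (b Bool.≟ true)) (f (x ∷ w)))
                                                       (dec-false (n ℕ.≟ x) (All.lookup (top∉range1 L) x∈))))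
                           (∑Inj-zero _ L)
  topHead : ∑Inj (remove n (range1 L ++ [ n ])) L (λ w → when (isTop (n ∷ w)) (f (n ∷ w)))
            ≡ ∑Inj (range1 L) L (λ w → f (n ∷ w))
  topHead = trans (cong (λ S → ∑Inj S L (λ w → when (isTop (n ∷ w)) (f (n ∷ w)))) (remove-snoc-self (top∉range1 L)))
                  (∑Inj-cong (range1 L) L (λ w → cong (λ b → when (does (b Bool.≟ true)) (f (n ∷ w)))
                                                     (dec-true (n ℕ.≟ n) refl)))

-- Descent statistics and α V

pattern asc  = false
pattern desc = true

isPair : Bool × Bool → Bool → Bool → ℕ
isPair (p , q) t t′ = when (does (p Bool.≟ t) ∧ does (q Bool.≟ t′)) 1

#pairs : Bool × Bool → Bool → List Bool → ℕ
#pairs pq t []        = 0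
#pairs pq t (t′ ∷ ts) = isPair pq t t′ + #pairs pq t′ ts

-- α V read off the descent indicators: an ascent after an ascent is an m, a descent followed by an
-- ascent is a d̄ (and that ascent an m̄), and a descent followed by a descent is a d.
stat : Bool → List Bool → Mono
stat t ts =
  (#pairs (asc , asc) t ts , #pairs (desc , asc) t ts , #pairs (desc , desc) t ts , #pairs (desc , asc) t ts)

pairStat : Bool → Bool → Mono
pairStat t t′ =
  (isPair (asc , asc) t t′ , isPair (desc , asc) t t′ , isPair (desc , desc) t t′ , isPair (desc , asc) t t′)

EndsInAscent : List Bool → Set
EndsInAscent []           = ⊥
EndsInAscent (t ∷ [])     = t ≡ asc
EndsInAscent (_ ∷ t ∷ ts) = EndsInAscent (t ∷ ts)

-- The descents of x ∷ w followed by the closing ascent into a letter above all of them.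
tailDescents : ℕ → List ℕ → List Bool
tailDescents x []      = asc ∷ []
tailDescents x (y ∷ w) = (y <ᵇ x) ∷ tailDescents y w

tailDescents-endsInAscent : ∀ x w → EndsInAscent (tailDescents x w)
tailDescents-endsInAscent x []          = refl
tailDescents-endsInAscent x (y ∷ [])    = refl
tailDescents-endsInAscent x (y ∷ z ∷ w) = tailDescents-endsInAscent y (z ∷ w)

<⇒<ᵇ≡true : ∀ {i j} → i < j → (i <ᵇ j) ≡ true
<⇒<ᵇ≡true {zero}  {suc j} _         = refl
<⇒<ᵇ≡true {suc i} {suc j} (s≤s i<j) = <⇒<ᵇ≡true i<j

<⇒>ᵇ≡false : ∀ {i j} → i < j → (j <ᵇ i) ≡ false
<⇒>ᵇ≡false {zero}  {suc j} _         = refl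
<⇒>ᵇ≡false {suc i} {suc j} (s≤s i<j) = <⇒>ᵇ≡false i<j

descents-top : ∀ {n} x w → All (_< n) (x ∷ w) → descents (n ∷ x ∷ w) ≡ desc ∷ tailDescents x w
descents-top {n} x []      (x<n ∷ [])        = cong₂ (λ a b → a ∷ b ∷ []) (<⇒<ᵇ≡true x<n) (<⇒>ᵇ≡false x<n)
descents-top {n} x (y ∷ w) (x<n ∷ y<n ∷ w<n) =
  cong₂ _∷_ (<⇒<ᵇ≡true x<n) (cong ((y <ᵇ x) ∷_) (List.∷-injectiveʳ (descents-top y w (y<n ∷ w<n))))

-- tailStat [] is a junk value.
tailStat : List ℕ → Mono
tailStat []      = oneM
tailStat (x ∷ w) = stat desc (tailDescents x w)

letterMono : Letter → Mono
letterMono m = (1 , 0 , 0 , 0)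
letterMono m̄ = (0 , 1 , 0 , 0)
letterMono d = (0 , 0 , 1 , 0)
letterMono d̄ = (0 , 0 , 0 , 1)

mono : List Letter → Mono
mono []       = oneM
mono (l ∷ ls) = letterMono l *M mono ls

α≡monomial : ∀ w → α w ≡ (ℤ.+ 1 , mono w) ∷ []
α≡monomial []       = refl
α≡monomial (l ∷ ls) rewrite α≡monomial ls with l
... | m = refl
... | m̄ = refl
... | d = refl
... | d̄ = refl

ascentMono : Bool → Bool → Mono
ascentMono desc asc  = letterMono m̄
ascentMono asc  asc  = letterMono m
ascentMono _    desc = oneM

mono-vword : ∀ t₀ t ts → EndsInAscent (t ∷ ts) → mono (vword (just t₀) (t ∷ ts)) ≡ ascentMono t₀ t *M stat t ts
mono-vword desc asc []        refl = refl
mono-vword asc  asc []        refl = refl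
mono-vword t₀   t   (t₁ ∷ ts) e    =
  trans (cong (letterMono (letter (just t₀) t (just t₁)) *M_) (mono-vword t t₁ ts e)) (step t₀ t t₁)
  where
  step : ∀ t₀ t t₁ → letterMono (letter (just t₀) t (just t₁)) *M (ascentMono t t₁ *M stat t₁ ts)
                     ≡ ascentMono t₀ t *M stat t (t₁ ∷ ts)
  step desc desc desc = refl
  step desc desc asc  = refl
  step desc asc  desc = refl
  step desc asc  asc  = refl
  step asc  desc desc = refl
  step asc  desc asc  = refl
  step asc  asc  desc = refl
  step asc  asc  asc  = refl

mono-V : ∀ {n} x w → All (_< n) (x ∷ w) → mono (V (n ∷ x ∷ w)) ≡ tailStat (x ∷ w)
mono-V x w w<n = trans (cong (λ ts → mono (vword nothing ts)) (descents-top x w w<n))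
                       (top (tailDescents x w) (tailDescents-endsInAscent x w))
  where
  top : ∀ ts → EndsInAscent ts → mono (vword nothing (desc ∷ ts)) ≡ stat desc ts
  top (desc ∷ ts) e = cong (letterMono d *M_) (mono-vword desc desc ts e)
  top (asc  ∷ ts) e = cong (letterMono d̄ *M_) (mono-vword desc asc ts e)

-- Inserting the maximum letter

-- Inserting the maximum lowers some exponents, so moves act on exponent vectors in ℤ⁴. A move is
-- named after the substitution it performs on α V.
ℤ⁴ : Set
ℤ⁴ = ℤ × ℤ × ℤ × ℤ

_⊕_ : ℤ⁴ → ℤ⁴ → ℤ⁴
(a , b , c , e) ⊕ (a′ , b′ , c′ , e′) = (a ℤ.+ a′ , b ℤ.+ b′ , c ℤ.+ c′ , e ℤ.+ e′)

embed : Mono → ℤ⁴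
embed (a , b , c , e) = (ℤ.+ a , ℤ.+ b , ℤ.+ c , ℤ.+ e)

data Move : Set where
  m̄↦m̄d m̄↦m̄m m↦m̄d̄ d↦m̄d̄ : Move

allMoves : List Move
allMoves = m̄↦m̄d ∷ m̄↦m̄m ∷ m↦m̄d̄ ∷ d↦m̄d̄ ∷ []

apply : Move → ℤ⁴ → ℤ⁴
apply m̄↦m̄d (a , b , c , e) = (a , b , ℤ.suc c , e)
apply m̄↦m̄m (a , b , c , e) = (ℤ.suc a , b , c , e)
apply m↦m̄d̄ (a , b , c , e) = (ℤ.pred a , ℤ.suc b , c , ℤ.suc e)
apply d↦m̄d̄ (a , b , c , e) = (a , ℤ.suc b , ℤ.pred c , ℤ.suc e)

+-sucʳ : ∀ i j → i ℤ.+ ℤ.suc j ≡ ℤ.suc (i ℤ.+ j)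
+-sucʳ i j = trans (sym (ℤ.+-assoc i (ℤ.+ 1) j)) (trans (cong (ℤ._+ j) (ℤ.+-comm i (ℤ.+ 1))) (ℤ.+-assoc (ℤ.+ 1) i j))

⊕-apply : ∀ mv z z′ → z ⊕ apply mv z′ ≡ apply mv (z ⊕ z′)
⊕-apply m̄↦m̄d (a , b , c , e) (a′ , b′ , c′ , e′) = cong (λ x → (a ℤ.+ a′ , b ℤ.+ b′ , x , e ℤ.+ e′)) (+-sucʳ c c′)
⊕-apply m̄↦m̄m (a , b , c , e) (a′ , b′ , c′ , e′) = cong (λ x → (x , b ℤ.+ b′ , c ℤ.+ c′ , e ℤ.+ e′)) (+-sucʳ a a′)
⊕-apply m↦m̄d̄ (a , b , c , e) (a′ , b′ , c′ , e′)
  rewrite +-sucʳ b b′ | +-sucʳ e e′ | ℤ.+-pred a a′ = refl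
⊕-apply d↦m̄d̄ (a , b , c , e) (a′ , b′ , c′ , e′)
  rewrite +-sucʳ b b′ | +-sucʳ e e′ | ℤ.+-pred c c′ = refl

-- Inserting the maximum into the edge t, preceded by t₀ and followed by ts, turns it into an ascent
-- followed by a descent; inserting it into the closing ascent gives two ascents.
moveAt : Bool → Bool → List Bool → Move
moveAt _    _    []         = m̄↦m̄m
moveAt _    asc  (desc ∷ _) = m̄↦m̄d
moveAt _    asc  (asc ∷ _)  = m↦m̄d̄
moveAt desc desc (_ ∷ _)    = d↦m̄d̄
moveAt asc  desc (_ ∷ _)    = m̄↦m̄m

moves : Bool → List Bool → List Move
moves t₀ []       = []
moves t₀ (t ∷ ts) = moveAt t₀ t ts ∷ moves t ts

stat-split : ∀ t₀ t ts → EndsInAscent ts →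
             embed (stat t₀ (asc ∷ desc ∷ ts)) ≡ apply (moveAt t₀ t ts) (embed (stat t₀ (t ∷ ts)))
stat-split desc desc (desc ∷ ts) _ = refl
stat-split desc desc (asc  ∷ ts) _ = refl
stat-split desc asc  (desc ∷ ts) _ = refl
stat-split desc asc  (asc  ∷ ts) _ = refl
stat-split asc  desc (desc ∷ ts) _ = refl
stat-split asc  desc (asc  ∷ ts) _ = refl
stat-split asc  asc  (desc ∷ ts) _ = refl
stat-split asc  asc  (asc  ∷ ts) _ = refl

∑-insertions-tail : ∀ {M} x w t₀ (h : ℤ⁴ → ℕ) → x < M → All (_< M) w →
  ∑ (insertions M w) (λ v → h (embed (stat t₀ (tailDescents x v))))
  ≡ ∑ (moves t₀ (tailDescents x w)) (λ mv → h (apply mv (embed (stat t₀ (tailDescents x w)))))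
∑-insertions-tail x [] t₀ h x<M [] rewrite <⇒>ᵇ≡false x<M = cong (λ z → h z + 0) (appendAscent t₀)
  where
  appendAscent : ∀ t₀ → embed (stat t₀ (asc ∷ asc ∷ [])) ≡ apply m̄↦m̄m (embed (stat t₀ (asc ∷ [])))
  appendAscent desc = refl
  appendAscent asc  = refl
∑-insertions-tail {M} x (y ∷ w) t₀ h x<M (y<M ∷ w<M) = begin
    h (embed (stat t₀ (tailDescents x (M ∷ y ∷ w))))
      + ∑ (map (y ∷_) (insertions M w)) (λ v → h (embed (stat t₀ (tailDescents x v))))
  ≡⟨ cong₂ _+_ (cong h splitFirst) (∑-map (y ∷_) (insertions M w) _) ⟩
    h (apply (moveAt t₀ t T) s)
      + ∑ (insertions M w) (λ v → h (embed (pairStat t₀ t) ⊕ embed (stat t (tailDescents y v))))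
  ≡⟨ cong (h (apply (moveAt t₀ t T) s) +_) (∑-insertions-tail y w t (λ z → h (embed (pairStat t₀ t) ⊕ z)) y<M w<M) ⟩
    h (apply (moveAt t₀ t T) s) + ∑ (moves t T) (λ mv → h (embed (pairStat t₀ t) ⊕ apply mv (embed (stat t T))))
  ≡⟨ cong (h (apply (moveAt t₀ t T) s) +_)
          (∑-cong (moves t T) (λ mv → cong h (⊕-apply mv (embed (pairStat t₀ t)) (embed (stat t T))))) ⟩
    h (apply (moveAt t₀ t T) s) + ∑ (moves t T) (λ mv → h (apply mv s))
  ∎
  where
  open ≡-Reasoning
  t = y <ᵇ x
  T = tailDescents y w
  s = embed (stat t₀ (t ∷ T))
  splitFirst : embed (stat t₀ (tailDescents x (M ∷ y ∷ w))) ≡ apply (moveAt t₀ t T) s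
  splitFirst = trans (cong (λ ts → embed (stat t₀ ts)) (cong₂ (λ a b → a ∷ b ∷ T) (<⇒>ᵇ≡false x<M) (<⇒<ᵇ≡true y<M)))
                     (stat-split t₀ t T (tailDescents-endsInAscent y w))

Tally : Set
Tally = ℕ × ℕ × ℕ × ℕ

_!_ : Tally → Move → ℕ
(k , _ , _ , _) ! m̄↦m̄d = k
(_ , k , _ , _) ! m̄↦m̄m = k
(_ , _ , k , _) ! m↦m̄d̄ = k
(_ , _ , _ , k) ! d↦m̄d̄ = k

one : Move → Tally
one m̄↦m̄d = (1 , 0 , 0 , 0)
one m̄↦m̄m = (0 , 1 , 0 , 0)
one m↦m̄d̄ = (0 , 0 , 1 , 0)
one d↦m̄d̄ = (0 , 0 , 0 , 1)

tally : List Move → Tally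
tally []         = (0 , 0 , 0 , 0)
tally (mv ∷ mvs) = one mv *M tally mvs

!-*M : ∀ k l mv → (k *M l) ! mv ≡ k ! mv + l ! mv
!-*M k l m̄↦m̄d = refl
!-*M k l m̄↦m̄m = refl
!-*M k l m↦m̄d̄ = refl
!-*M k l d↦m̄d̄ = refl

∑-one : ∀ mv (F : Move → ℕ) → ∑ allMoves (λ mv′ → one mv ! mv′ * F mv′) ≡ F mv
∑-one m̄↦m̄d F = trans (ℕ.+-identityʳ _) (ℕ.+-identityʳ _)
∑-one m̄↦m̄m F = trans (ℕ.+-identityʳ _) (ℕ.+-identityʳ _)
∑-one m↦m̄d̄ F = trans (ℕ.+-identityʳ _) (ℕ.+-identityʳ _)
∑-one d↦m̄d̄ F = trans (ℕ.+-identityʳ _) (ℕ.+-identityʳ _)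

∑-tally : ∀ mvs (F : Move → ℕ) → ∑ mvs F ≡ ∑ allMoves (λ mv → tally mvs ! mv * F mv)
∑-tally []         F = refl
∑-tally (mv ∷ mvs) F = begin
    F mv + ∑ mvs F
  ≡⟨ cong₂ _+_ (sym (∑-one mv F)) (∑-tally mvs F) ⟩
    ∑ allMoves byOne + ∑ allMoves byRest
  ≡⟨ ∑-+ allMoves byOne byRest ⟨
    ∑ allMoves (λ mv′ → byOne mv′ + byRest mv′)
  ≡⟨ ∑-cong allMoves (λ mv′ → trans (sym (ℕ.*-distribʳ-+ (F mv′) (one mv ! mv′) _))
                                    (cong (_* F mv′) (sym (!-*M (one mv) (tally mvs) mv′)))) ⟩
    ∑ allMoves (λ mv′ → tally (mv ∷ mvs) ! mv′ * F mv′)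
  ∎
  where
  open ≡-Reasoning
  byOne byRest : Move → ℕ
  byOne  mv′ = one mv ! mv′ * F mv′
  byRest mv′ = tally mvs ! mv′ * F mv′

tally-moves : ∀ t₀ t ts → EndsInAscent (t ∷ ts) →
  tally (moves t₀ (t ∷ ts)) ≡ ( #pairs (asc , desc) t ts , suc (#pairs (asc , desc) t₀ (t ∷ ts))
                             , #pairs (asc , asc) t ts , #pairs (desc , desc) t₀ (t ∷ ts) )
tally-moves desc asc []        refl = refl
tally-moves asc  asc []        refl = refl
tally-moves t₀   t   (t₁ ∷ ts) e    =
  trans (cong (one (moveAt t₀ t (t₁ ∷ ts)) *M_) (tally-moves t t₁ ts e)) (step t₀ t t₁)
  where
  step : ∀ t₀ t t₁ →
    one (moveAt t₀ t (t₁ ∷ ts)) *M ( #pairs (asc , desc) t₁ ts , suc (#pairs (asc , desc) t (t₁ ∷ ts))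
                                   , #pairs (asc , asc) t₁ ts , #pairs (desc , desc) t (t₁ ∷ ts) )
    ≡ ( #pairs (asc , desc) t (t₁ ∷ ts) , suc (#pairs (asc , desc) t₀ (t ∷ t₁ ∷ ts))
      , #pairs (asc , asc) t (t₁ ∷ ts) , #pairs (desc , desc) t₀ (t ∷ t₁ ∷ ts) )
  step desc desc desc = refl
  step desc desc asc  = refl
  step desc asc  desc = refl
  step desc asc  asc  = refl
  step asc  desc desc = refl
  step asc  desc asc  = refl
  step asc  asc  desc = refl
  step asc  asc  asc  = refl

-- Every run of descents ends with a DA pair, as the sequence ends with an ascent, and begins with an
-- AD pair unless it starts the sequence.
#DA≡#AD : ∀ t₀ t ts → EndsInAscent (t ∷ ts) →
          #pairs (desc , asc) t₀ (t ∷ ts) ≡ when t₀ 1 + #pairs (asc , desc) t₀ (t ∷ ts)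
#DA≡#AD desc asc  []        refl = refl
#DA≡#AD asc  asc  []        refl = refl
#DA≡#AD desc desc (t₁ ∷ ts) e    = #DA≡#AD desc t₁ ts e
#DA≡#AD desc asc  (t₁ ∷ ts) e    = cong suc (#DA≡#AD asc t₁ ts e)
#DA≡#AD asc  desc (t₁ ∷ ts) e    = #DA≡#AD desc t₁ ts e
#DA≡#AD asc  asc  (t₁ ∷ ts) e    = #DA≡#AD asc t₁ ts e

moveTally : Mono → Tally
moveTally (a , b , c , e) = (b , b , a , c)

tally-insertions : ∀ ts → EndsInAscent ts → tally (m̄↦m̄d ∷ moves desc ts) ≡ moveTally (stat desc ts)
tally-insertions (t ∷ ts) e =
  trans (cong (one m̄↦m̄d *M_) (tally-moves desc t ts e))
        (cong (λ k → (k , k , #pairs (asc , asc) desc (t ∷ ts) , #pairs (desc , desc) desc (t ∷ ts)))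
              (sym (#DA≡#AD desc t ts e)))

∑-insertions : ∀ {M} x w (h : ℤ⁴ → ℕ) → x < M → All (_< M) w →
  ∑ (insertions M (x ∷ w)) (λ v → h (embed (tailStat v)))
  ≡ ∑ allMoves (λ mv → moveTally (tailStat (x ∷ w)) ! mv * h (apply mv (embed (tailStat (x ∷ w)))))
∑-insertions {M} x w h x<M w<M = begin
    h (embed (stat desc ((x <ᵇ M) ∷ T))) + ∑ (map (x ∷_) (insertions M w)) (λ v → h (embed (tailStat v)))
  ≡⟨ cong₂ _+_ (cong (λ t → h (embed (stat desc (t ∷ T)))) (<⇒<ᵇ≡true x<M))
               (trans (∑-map (x ∷_) (insertions M w) _) (∑-insertions-tail x w desc h x<M w<M)) ⟩
    ∑ (m̄↦m̄d ∷ moves desc T) (λ mv → h (apply mv s))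
  ≡⟨ ∑-tally (m̄↦m̄d ∷ moves desc T) _ ⟩
    ∑ allMoves (λ mv → tally (m̄↦m̄d ∷ moves desc T) ! mv * h (apply mv s))
  ≡⟨ cong (λ k → ∑ allMoves (λ mv → k ! mv * h (apply mv s))) (tally-insertions T (tailDescents-endsInAscent x w)) ⟩
    ∑ allMoves (λ mv → moveTally (stat desc T) ! mv * h (apply mv s))
  ∎
  where
  open ≡-Reasoning
  T = tailDescents x w
  s = embed (stat desc T)

-- The derivation on coefficient functions

δ : Mono → Mono → ℕ
δ s μ = when (does (s ≟M μ)) 1

_≟ℤ⁴_ : (z z′ : ℤ⁴) → Dec (z ≡ z′)
_≟ℤ⁴_ = ≡-dec ℤ._≟_ (≡-dec ℤ._≟_ (≡-dec ℤ._≟_ ℤ._≟_))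

embed-injective : ∀ {s μ} → embed s ≡ embed μ → s ≡ μ
embed-injective {_ , _ , _ , _} {_ , _ , _ , _} refl = refl

δ-embed : ∀ s μ → δ s μ ≡ when (does (embed s ≟ℤ⁴ embed μ)) 1
δ-embed s μ = cong (λ b → when b 1) (does-⇔ (mk⇔ (cong embed) embed-injective) (s ≟M μ) (embed s ≟ℤ⁴ embed μ))

source : Move → Mono → Maybe Mono
source m̄↦m̄d (a , b , suc c , e)     = just (a , b , c , e)
source m̄↦m̄m (suc a , b , c , e)     = just (a , b , c , e)
source m↦m̄d̄ (a , suc b , c , suc e) = just (suc a , b , c , e)
source d↦m̄d̄ (a , suc b , c , suc e) = just (a , b , suc c , e)
source _     _                       = nothing

apply⇒source : ∀ mv s μ → apply mv (embed s) ≡ embed μ → source mv μ ≡ just s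
apply⇒source m̄↦m̄d _                   _ refl = refl
apply⇒source m̄↦m̄m _                   _ refl = refl
apply⇒source m↦m̄d̄ (zero , _ , _ , _)  _ ()
apply⇒source m↦m̄d̄ (suc a , _ , _ , _) _ refl = refl
apply⇒source d↦m̄d̄ (_ , _ , zero , _)  _ ()
apply⇒source d↦m̄d̄ (_ , _ , suc c , _) _ refl = refl

source⇒apply : ∀ mv s μ → source mv μ ≡ just s → apply mv (embed s) ≡ embed μ
source⇒apply m̄↦m̄d _ (_ , _ , suc _ , _)     refl = refl
source⇒apply m̄↦m̄m _ (suc _ , _ , _ , _)     refl = refl
source⇒apply m↦m̄d̄ _ (_ , suc _ , _ , suc _) refl = refl
source⇒apply d↦m̄d̄ _ (_ , suc _ , _ , suc _) refl = refl
source⇒apply m̄↦m̄d _ (_ , _ , zero , _)      ()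
source⇒apply m̄↦m̄m _ (zero , _ , _ , _)      ()
source⇒apply m↦m̄d̄ _ (_ , zero , _ , _)      ()
source⇒apply m↦m̄d̄ _ (_ , suc _ , _ , zero)  ()
source⇒apply d↦m̄d̄ _ (_ , zero , _ , _)      ()
source⇒apply d↦m̄d̄ _ (_ , suc _ , _ , zero)  ()

derivTerm : Move → Mono → (Mono → ℕ) → ℕ
derivTerm mv μ f = maybe (λ ν → moveTally ν ! mv * f ν) 0 (source mv μ)

-- The coefficient of μ in D p, where f gives the coefficients of p.
derivCoeff : Mono → (Mono → ℕ) → ℕ
derivCoeff μ f = ∑ allMoves (λ mv → derivTerm mv μ f)

derivCoeff-cong : ∀ μ {f g : Mono → ℕ} → (∀ ν → f ν ≡ g ν) → derivCoeff μ f ≡ derivCoeff μ g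
derivCoeff-cong μ {f} {g} eq = ∑-cong allMoves term
  where
  term : ∀ mv → derivTerm mv μ f ≡ derivTerm mv μ g
  term mv with source mv μ
  ... | nothing = refl
  ... | just ν  = cong (moveTally ν ! mv *_) (eq ν)

derivCoeff-when : ∀ μ {P : Mono → Set} {Q : Set} (P? : ∀ ν → Dec (P ν)) (Q? : Dec Q) (f : Mono → ℕ) →
                  (∀ mv ν → source mv μ ≡ just ν → P ν ⇔ Q) →
                  derivCoeff μ (λ ν → when (does (P? ν)) (f ν)) ≡ when (does Q?) (derivCoeff μ f)
derivCoeff-when μ P? Q? f P⇔Q = trans (∑-cong allMoves term) (∑-when allMoves (does Q?) (λ mv → derivTerm mv μ f))
  where
  term : ∀ mv → derivTerm mv μ (λ ν → when (does (P? ν)) (f ν)) ≡ when (does Q?) (derivTerm mv μ f)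
  term mv with source mv μ in eq
  ... | nothing = sym (when-zero (does Q?))
  ... | just ν  = trans (*-when (moveTally ν ! mv) (does (P? ν)) (f ν))
                        (cong (λ b → when b (moveTally ν ! mv * f ν)) (does-⇔ (P⇔Q mv ν eq) (P? ν) Q?))

derivTerm-δ : ∀ mv s μ → moveTally s ! mv * when (does (apply mv (embed s) ≟ℤ⁴ embed μ)) 1 ≡ derivTerm mv μ (δ s)
derivTerm-δ mv s μ with source mv μ in eq | apply mv (embed s) ≟ℤ⁴ embed μ
... | nothing | yes s↦μ = contradiction (trans (sym eq) (apply⇒source mv s μ s↦μ)) λ ()
... | nothing | no _    = ℕ.*-zeroʳ (moveTally s ! mv)
... | just ν  | yes s↦μ with trans (sym eq) (apply⇒source mv s μ s↦μ)
...   | refl = cong (moveTally s ! mv *_) (sym (when-yes (s ≟M s) refl))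
derivTerm-δ mv s μ | just ν | no s↦̸μ =
  trans (ℕ.*-zeroʳ (moveTally s ! mv))
        (sym (trans (cong (moveTally ν ! mv *_) (when-no (s ≟M ν) s≢ν)) (ℕ.*-zeroʳ (moveTally ν ! mv))))
  where
  s≢ν : s ≢ ν
  s≢ν refl = s↦̸μ (source⇒apply mv s μ eq)

∑-insertions-δ : ∀ {M} x w μ → x < M → All (_< M) w →
                 ∑ (insertions M (x ∷ w)) (λ v → δ (tailStat v) μ) ≡ derivCoeff μ (δ (tailStat (x ∷ w)))
∑-insertions-δ x w μ x<M w<M =
  trans (∑-cong (insertions _ (x ∷ w)) (λ v → δ-embed (tailStat v) μ))
        (trans (∑-insertions x w (λ z → when (does (z ≟ℤ⁴ embed μ)) 1) x<M w<M)
               (∑-cong allMoves (λ mv → derivTerm-δ mv (tailStat (x ∷ w)) μ)))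

∑Inj-derivCoeff : ∀ S k (g : List ℕ → Mono → ℕ) μ →
                  ∑Inj S k (λ w → derivCoeff μ (g w)) ≡ derivCoeff μ (λ ν → ∑Inj S k (λ w → g w ν))
∑Inj-derivCoeff S k g μ = trans (∑Inj-∑ S k allMoves (λ w mv → derivTerm mv μ (g w))) (∑-cong allMoves term)
  where
  term : ∀ mv → ∑Inj S k (λ w → derivTerm mv μ (g w)) ≡ derivTerm mv μ (λ ν → ∑Inj S k (λ w → g w ν))
  term mv with source mv μ
  ... | nothing = ∑Inj-zero S k
  ... | just ν  = ∑Inj-* S k (moveTally ν ! mv) (λ w → g w ν)

-- Coefficients of the left-hand side

coeff-++ : ∀ p q μ → coeff (p ++ q) μ ≡ coeff p μ ℤ.+ coeff q μ
coeff-++ []             q μ = sym (ℤ.+-identityˡ _)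
coeff-++ ((c , ν) ∷ p) q μ = trans (cong (ℤ._+_ cν) (coeff-++ p q μ)) (sym (ℤ.+-assoc cν (coeff p μ) (coeff q μ)))
  where cν = if does (ν ≟M μ) then c else ℤ.+ 0

coeff-sumP : {A : Set} (xs : List A) (F : A → Poly) (g : A → ℕ) → ∀ μ →
             (∀ x → coeff (F x) μ ≡ ℤ.+ g x) → coeff (sumP (map F xs)) μ ≡ ℤ.+ ∑ xs g
coeff-sumP []       F g μ eq = refl
coeff-sumP (x ∷ xs) F g μ eq = trans (coeff-++ (F x) _ μ) (cong₂ ℤ._+_ (eq x) (coeff-sumP xs F g μ eq))

coeff-α : ∀ w μ → coeff (α w) μ ≡ ℤ.+ δ (mono w) μ
coeff-α w μ rewrite α≡monomial w with does (mono w ≟M μ)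
... | true  = refl
... | false = refl

-- lhsCount ℓ is the coefficient function of lhs (ℓ + 1).
lhsCount : ℕ → Mono → ℕ
lhsCount ℓ μ = ∑Inj (range1 ℓ) ℓ (λ w → δ (tailStat w) μ)

coeff-lhs : ∀ L μ → coeff (lhs (suc (suc L))) μ ≡ ℤ.+ lhsCount (suc L) μ
coeff-lhs L μ = trans (coeff-sumP (perms' n) (λ σ → α (V σ)) (λ σ → δ (mono (V σ)) μ) μ (λ σ → coeff-α (V σ) μ))
                      (cong ℤ.+_ (trans (∑-perms' (suc L) _) (∑Inj-cong-words (range1 (suc L)) (suc L) topped)))
  where
  n = suc (suc L)
  topped : ∀ {w} → length w ≡ suc L → All (_∈ range1 (suc L)) w → δ (mono (V (n ∷ w))) μ ≡ δ (tailStat w) μ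
  topped {x ∷ w} _ w⊆ = cong (λ s → δ s μ) (mono-V x w (All.map (All.lookup (range1-< (suc L))) w⊆))

lhsCount-suc : ∀ ℓ μ → lhsCount (suc (suc ℓ)) μ ≡ derivCoeff μ (lhsCount (suc ℓ))
lhsCount-suc ℓ μ = begin
    ∑Inj (range1 L ++ [ suc L ]) (suc L) (λ v → δ (tailStat v) μ)
  ≡⟨ ∑Inj-snoc (suc L) L (range1 L) (length-range1 L) (top∉range1 L) (unique-range1 L) _ ⟩
    ∑Inj (range1 L) L (λ w → ∑ (insertions (suc L) w) (λ v → δ (tailStat v) μ))
  ≡⟨ ∑Inj-cong-words (range1 L) L insert ⟩
    ∑Inj (range1 L) L (λ w → derivCoeff μ (δ (tailStat w)))
  ≡⟨ ∑Inj-derivCoeff (range1 L) L (λ w → δ (tailStat w)) μ ⟩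
    derivCoeff μ (lhsCount L)
  ∎
  where
  open ≡-Reasoning
  L = suc ℓ
  insert : ∀ {w} → length w ≡ L → All (_∈ range1 L) w →
           ∑ (insertions (suc L) w) (λ v → δ (tailStat v) μ) ≡ derivCoeff μ (δ (tailStat w))
  insert {x ∷ w} _ (x∈ ∷ w⊆) = ∑-insertions-δ x w μ (All.lookup (range1-< L) x∈) (All.map (All.lookup (range1-< L)) w⊆)

-- The closed form of the coefficients

-- binom a c = (a + c choose a)
binom : ℕ → ℕ → ℕ
binom zero    c       = 1
binom (suc a) zero    = 1
binom (suc a) (suc c) = binom a (suc c) + binom (suc a) c

binom-zeroʳ : ∀ a → binom a 0 ≡ 1
binom-zeroʳ zero    = refl
binom-zeroʳ (suc a) = refl

binom-comm : ∀ a c → binom a c ≡ binom c a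
binom-comm zero    zero    = refl
binom-comm zero    (suc c) = refl
binom-comm (suc a) zero    = refl
binom-comm (suc a) (suc c) =
  trans (cong₂ _+_ (binom-comm a (suc c)) (binom-comm (suc a) c)) (ℕ.+-comm (binom (suc c) a) (binom c (suc a)))

binom-oneˡ : ∀ c → binom 1 c ≡ suc c
binom-oneˡ zero    = refl
binom-oneˡ (suc c) = cong suc (binom-oneˡ c)

binom-absorbˡ : ∀ a c → suc a * binom (suc a) c ≡ suc (a + c) * binom a c
binom-absorbˡ a       zero    rewrite ℕ.+-identityʳ a | binom-zeroʳ a = refl
binom-absorbˡ zero    (suc c) = trans (ℕ.*-identityˡ _) (trans (cong suc (binom-oneˡ c)) (sym (ℕ.*-identityʳ _)))
binom-absorbˡ (suc a) (suc c) = begin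
    (2 + a) * (x + y + z)
  ≡⟨ split a x y z ⟩
    (x + y) + ((1 + a) * (x + y) + (2 + a) * z)
  ≡⟨ cong (λ t → (x + y) + t) (cong₂ _+_ (trans (binom-absorbˡ a (suc c)) (cong (λ t → suc t * x) (ℕ.+-suc a c)))
                                         (binom-absorbˡ (suc a) c)) ⟩
    (x + y) + ((2 + a + c) * x + (2 + a + c) * y)
  ≡⟨ merge a c x y ⟩
    (3 + a + c) * (x + y)
  ≡⟨ cong (λ t → suc (suc t) * (x + y)) (sym (ℕ.+-suc a c)) ⟩
    suc (suc a + suc c) * binom (suc a) (suc c)
  ∎
  where
  open ≡-Reasoning
  x = binom a (suc c)
  y = binom (suc a) c
  z = binom (suc (suc a)) c
  split : ∀ a x y z → (2 + a) * (x + y + z) ≡ (x + y) + ((1 + a) * (x + y) + (2 + a) * z)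
  split = solve-∀
  merge : ∀ a c x y → (x + y) + ((2 + a + c) * x + (2 + a + c) * y) ≡ (3 + a + c) * (x + y)
  merge = solve-∀

binom-absorbʳ : ∀ a c → suc c * binom a (suc c) ≡ suc (a + c) * binom a c
binom-absorbʳ a c = begin
  suc c * binom a (suc c)   ≡⟨ cong (suc c *_) (binom-comm a (suc c)) ⟩
  suc c * binom (suc c) a   ≡⟨ binom-absorbˡ c a ⟩
  suc (c + a) * binom c a   ≡⟨ cong₂ (λ s b → suc s * b) (ℕ.+-comm c a) (binom-comm c a) ⟩
  suc (a + c) * binom a c   ∎
  where open ≡-Reasoning

-- γ k j = c_{2k+j,k} is the coefficient of u^k v^j; it is read off from
-- D (u^k v^j) = k u^k v^(j+1) + 2j u^(k+1) v^(j-1).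
γ : ℕ → ℕ → ℕ
γ zero          j       = 0
γ (suc k)       (suc j) = suc k * γ (suc k) j + 2 * (j + 2) * γ k (suc (suc j))
γ (suc zero)    zero    = 1
γ (suc (suc k)) zero    = 2 * γ (suc k) 1

closedValue : Mono → ℕ
closedValue (a , b , c , e) = γ b (a + c) * binom a c

degree : Mono → ℕ
degree (a , b , c , e) = a + b + c + e

Balanced : Mono → Set
Balanced (a , b , c , e) = e ≡ b

Admissible : ℕ → Mono → Set
Admissible n μ = Balanced μ × degree μ ≡ n

admissible? : ∀ n μ → Dec (Admissible n μ)
admissible? n (a , b , c , e) = (e ℕ.≟ b) ×-dec (degree (a , b , c , e) ℕ.≟ n)

closedCoeff : ℕ → Mono → ℕ
closedCoeff n μ = when (does (admissible? n μ)) (closedValue μ)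

source-shape : ∀ mv ν μ → source mv μ ≡ just ν → (Balanced ν ⇔ Balanced μ) × suc (degree ν) ≡ degree μ
source-shape m̄↦m̄d _ (a , b , suc c , e)     refl = mk⇔ id id , lemma a b c e
  where
  lemma : ∀ a b c e → suc (a + b + c + e) ≡ a + b + suc c + e
  lemma = solve-∀
source-shape m̄↦m̄m _ (suc a , b , c , e)     refl = mk⇔ id id , refl
source-shape m↦m̄d̄ _ (a , suc b , c , suc e) refl = mk⇔ (cong suc) ℕ.suc-injective , lemma a b c e
  where
  lemma : ∀ a b c e → suc (suc a + b + c + e) ≡ a + suc b + c + suc e
  lemma = solve-∀
source-shape d↦m̄d̄ _ (a , suc b , c , suc e) refl = mk⇔ (cong suc) ℕ.suc-injective , lemma a b c e
  where
  lemma : ∀ a b c e → suc (a + b + suc c + e) ≡ a + suc b + c + suc e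
  lemma = solve-∀
source-shape m̄↦m̄d _ (_ , _ , zero , _)      ()
source-shape m̄↦m̄m _ (zero , _ , _ , _)      ()
source-shape m↦m̄d̄ _ (_ , zero , _ , _)      ()
source-shape m↦m̄d̄ _ (_ , suc _ , _ , zero)  ()
source-shape d↦m̄d̄ _ (_ , zero , _ , _)      ()
source-shape d↦m̄d̄ _ (_ , suc _ , _ , zero)  ()

source-admissible : ∀ n mv ν μ → source mv μ ≡ just ν → Admissible n ν ⇔ Admissible (suc n) μ
source-admissible n mv ν μ eq with source-shape mv ν μ eq
... | bal , deg = mk⇔ (λ { (balanced , n≡) → Equivalence.to bal balanced , trans (sym deg) (cong suc n≡) })
                      (λ { (balanced , n≡) → Equivalence.from bal balanced , ℕ.suc-injective (trans deg n≡) })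

∑-allMoves : ∀ (g : Move → ℕ) → ∑ allMoves g ≡ (g m̄↦m̄d + g m̄↦m̄m) + (g m↦m̄d̄ + g d↦m̄d̄)
∑-allMoves g = regroup (g m̄↦m̄d) (g m̄↦m̄m) (g m↦m̄d̄) (g d↦m̄d̄)
  where
  regroup : ∀ x y z w → x + (y + (z + (w + 0))) ≡ (x + y) + (z + w)
  regroup = solve-∀

closedValue-m̄-moves : ∀ A k C j → A + C ≡ suc j →
          derivTerm m̄↦m̄d (A , suc k , C , suc k) closedValue + derivTerm m̄↦m̄m (A , suc k , C , suc k) closedValue
          ≡ suc k * (γ (suc k) j * binom A C)
closedValue-m̄-moves zero    k (suc C) .C           refl = ℕ.+-identityʳ _
closedValue-m̄-moves (suc A) k zero    .(A + 0)     refl = cong (λ b → suc k * (γ (suc k) (A + 0) * b)) (binom-zeroʳ A)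
closedValue-m̄-moves (suc A) k (suc C) .(A + suc C) refl = begin
    suc k * (γ (suc k) (suc A + C) * binom (suc A) C) + suc k * (γ (suc k) (A + suc C) * binom A (suc C))
  ≡⟨ cong (λ i → suc k * (γ (suc k) i * binom (suc A) C) + suc k * (γ (suc k) (A + suc C) * binom A (suc C)))
          (sym (ℕ.+-suc A C)) ⟩
    suc k * (g * binom (suc A) C) + suc k * (g * binom A (suc C))
  ≡⟨ pascal (suc k) g (binom (suc A) C) (binom A (suc C)) ⟩
    suc k * (g * (binom A (suc C) + binom (suc A) C))
  ∎
  where
  open ≡-Reasoning
  g = γ (suc k) (A + suc C)
  pascal : ∀ k g x y → k * (g * x) + k * (g * y) ≡ k * (g * (y + x))
  pascal = solve-∀

closedValue-d̄-moves : ∀ A k C →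
          derivTerm m↦m̄d̄ (A , suc k , C , suc k) closedValue + derivTerm d↦m̄d̄ (A , suc k , C , suc k) closedValue
          ≡ 2 * (γ k (suc (A + C)) * (suc (A + C) * binom A C))
closedValue-d̄-moves A k C = begin
    suc A * (γ k (suc A + C) * binom (suc A) C) + suc C * (γ k (A + suc C) * binom A (suc C))
  ≡⟨ cong (λ i → suc A * (g * binom (suc A) C) + suc C * (γ k i * binom A (suc C))) (ℕ.+-suc A C) ⟩
    suc A * (g * binom (suc A) C) + suc C * (g * binom A (suc C))
  ≡⟨ cong₂ _+_ (swap (suc A) g _) (swap (suc C) g _) ⟩
    g * (suc A * binom (suc A) C) + g * (suc C * binom A (suc C))
  ≡⟨ cong₂ (λ x y → g * x + g * y) (binom-absorbˡ A C) (binom-absorbʳ A C) ⟩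
    g * (suc (A + C) * binom A C) + g * (suc (A + C) * binom A C)
  ≡⟨ cong (g * (suc (A + C) * binom A C) +_) (sym (ℕ.+-identityʳ _)) ⟩
    2 * (g * (suc (A + C) * binom A C))
  ∎
  where
  open ≡-Reasoning
  g = γ k (suc (A + C))
  swap : ∀ a g b → a * (g * b) ≡ g * (a * b)
  swap = solve-∀

closedValue-rec⁺ : ∀ A k C j → A + C ≡ suc j →
             closedValue (A , suc k , C , suc k) ≡ derivCoeff (A , suc k , C , suc k) closedValue
closedValue-rec⁺ A k C j eq = begin
    γ (suc k) (A + C) * binom A C
  ≡⟨ cong (λ i → γ (suc k) i * binom A C) eq ⟩
    γ (suc k) (suc j) * binom A C
  ≡⟨ split k j (γ (suc k) j) (γ k (suc (suc j))) (binom A C) ⟩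
    suc k * (γ (suc k) j * binom A C) + 2 * (γ k (suc (suc j)) * (suc (suc j) * binom A C))
  ≡⟨ cong₂ _+_ (sym (closedValue-m̄-moves A k C j eq))
               (trans (cong (λ i → 2 * (γ k (suc i) * (suc i * binom A C))) (sym eq))
                      (sym (closedValue-d̄-moves A k C))) ⟩
    (derivTerm m̄↦m̄d μ closedValue + derivTerm m̄↦m̄m μ closedValue)
      + (derivTerm m↦m̄d̄ μ closedValue + derivTerm d↦m̄d̄ μ closedValue)
  ≡⟨ ∑-allMoves (λ mv → derivTerm mv μ closedValue) ⟨
    derivCoeff μ closedValue
  ∎
  where
  open ≡-Reasoning
  μ = (A , suc k , C , suc k)
  split : ∀ k j g₁ g₂ b → (suc k * g₁ + 2 * (j + 2) * g₂) * b ≡ suc k * (g₁ * b) + 2 * (g₂ * (suc (suc j) * b))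
  split = solve-∀

-- In degree 2 this fails for d̄m̄ itself, the start of the recursion.
closedValue-rec : ∀ A b C → 3 ≤ degree (A , b , C , b) →
                  closedValue (A , b , C , b) ≡ derivCoeff (A , b , C , b) closedValue
closedValue-rec zero    zero           zero    _ = refl
closedValue-rec zero    zero           (suc C) _ = refl
closedValue-rec (suc A) zero           zero    _ = refl
closedValue-rec (suc A) zero           (suc C) _ = refl
closedValue-rec zero    (suc zero)     zero    (s≤s (s≤s ()))
closedValue-rec zero    (suc (suc k))  zero    _ = double (γ (suc k) 1)
  where
  double : ∀ g → 2 * g * 1 ≡ 0 + (0 + (1 * (g * 1) + (1 * (g * 1) + 0)))
  double = solve-∀
closedValue-rec zero    (suc k)        (suc C) _ = closedValue-rec⁺ zero k (suc C) C refl
closedValue-rec (suc A) (suc k)        C       _ = closedValue-rec⁺ (suc A) k C (A + C) refl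

closedCoeff-suc : ∀ n → 2 ≤ n → ∀ μ → closedCoeff (suc n) μ ≡ derivCoeff μ (closedCoeff n)
closedCoeff-suc n 2≤n μ@(A , B , C , E) = sym (begin
    derivCoeff μ (closedCoeff n)
  ≡⟨ derivCoeff-when μ (admissible? n) (admissible? (suc n) μ) closedValue (λ mv ν → source-admissible n mv ν μ) ⟩
    when (does (admissible? (suc n) μ)) (derivCoeff μ closedValue)
  ≡⟨ when-cong (admissible? (suc n) μ)
                (λ { (refl , deg) → sym (closedValue-rec A B C (subst (3 ≤_) (sym deg) (s≤s 2≤n))) }) ⟩
    closedCoeff (suc n) μ
  ∎)
  where open ≡-Reasoning

degree≡2 : ∀ A k C → A + suc k + C + suc k ≡ 2 → A ≡ 0 × k ≡ 0 × C ≡ 0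
degree≡2 A k C deg = ℕ.m+n≡0⇒m≡0 A A+k≡0 , ℕ.m+n≡0⇒n≡0 (A + k + C) rest≡0 , ℕ.m+n≡0⇒n≡0 (A + k) A+k+C≡0
  where
  shift : ∀ A k C → A + suc k + C + suc k ≡ 2 + (A + k + C + k)
  shift = solve-∀
  rest≡0 : A + k + C + k ≡ 0
  rest≡0 = ℕ.suc-injective (ℕ.suc-injective (trans (sym (shift A k C)) deg))
  A+k+C≡0 : A + k + C ≡ 0
  A+k+C≡0 = ℕ.m+n≡0⇒m≡0 (A + k + C) rest≡0
  A+k≡0 : A + k ≡ 0
  A+k≡0 = ℕ.m+n≡0⇒m≡0 (A + k) A+k+C≡0

admissible-2⇒δ : ∀ μ → Admissible 2 μ → δ (0 , 1 , 0 , 1) μ ≡ closedValue μ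
admissible-2⇒δ (A , zero  , C , .zero)    (refl , _)   = when-no ((0 , 1 , 0 , 1) ≟M (A , 0 , C , 0)) (λ ())
admissible-2⇒δ (A , suc k , C , .(suc k)) (refl , deg) with degree≡2 A k C deg
... | refl , refl , refl = refl

closedCoeff-2 : ∀ μ → δ (0 , 1 , 0 , 1) μ ≡ closedCoeff 2 μ
closedCoeff-2 μ = byAdmissibility (admissible? 2 μ)
  where
  byAdmissibility : (adm? : Dec (Admissible 2 μ)) → δ (0 , 1 , 0 , 1) μ ≡ when (does adm?) (closedValue μ)
  byAdmissibility (yes adm)  = admissible-2⇒δ μ adm
  byAdmissibility (no ¬adm) = when-no ((0 , 1 , 0 , 1) ≟M μ) (λ { refl → ¬adm (refl , refl) })

lhsCount≡closedCoeff : ∀ ℓ μ → lhsCount (suc ℓ) μ ≡ closedCoeff (suc (suc ℓ)) μ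
lhsCount≡closedCoeff zero    μ = trans (ℕ.+-identityʳ _) (closedCoeff-2 μ)
lhsCount≡closedCoeff (suc ℓ) μ = begin
    lhsCount (suc (suc ℓ)) μ                ≡⟨ lhsCount-suc ℓ μ ⟩
    derivCoeff μ (lhsCount (suc ℓ))         ≡⟨ derivCoeff-cong μ (lhsCount≡closedCoeff ℓ) ⟩
    derivCoeff μ (closedCoeff (suc (suc ℓ)))   ≡⟨ closedCoeff-suc (suc (suc ℓ)) (s≤s (s≤s z≤n)) μ ⟨
    closedCoeff (suc (suc (suc ℓ))) μ          ∎
  where open ≡-Reasoning

-- Coefficients of the right-hand side

*M-cancelˡ : ∀ ν₀ {ν ν′} → ν₀ *M ν ≡ ν₀ *M ν′ → ν ≡ ν′
*M-cancelˡ (a , b , c , e) {a′ , b′ , c′ , e′} {A , B , C , E} eq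
  rewrite ℕ.+-cancelˡ-≡ a a′ A (cong proj₁ eq)
        | ℕ.+-cancelˡ-≡ b b′ B (cong (λ μ → proj₁ (proj₂ μ)) eq)
        | ℕ.+-cancelˡ-≡ c c′ C (cong (λ μ → proj₁ (proj₂ (proj₂ μ))) eq)
        | ℕ.+-cancelˡ-≡ e e′ E (cong (λ μ → proj₂ (proj₂ (proj₂ μ))) eq) = refl

coeff-*P-shift : ∀ c ν₀ ν q → coeff (((c , ν₀) ∷ []) *P q) (ν₀ *M ν) ≡ c ℤ.* coeff q ν
coeff-*P-shift c ν₀ ν []              = sym (ℤ.*-zeroʳ c)
coeff-*P-shift c ν₀ ν ((c′ , ν′) ∷ q) = begin
    (if does ((ν₀ *M ν′) ≟M (ν₀ *M ν)) then c ℤ.* c′ else ℤ.+ 0) ℤ.+ coeff (((c , ν₀) ∷ []) *P q) (ν₀ *M ν)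
  ≡⟨ cong₂ ℤ._+_ (cong (λ b → if b then c ℤ.* c′ else ℤ.+ 0)
                       (does-⇔ (mk⇔ (*M-cancelˡ ν₀) (cong (ν₀ *M_))) ((ν₀ *M ν′) ≟M (ν₀ *M ν)) (ν′ ≟M ν)))
                 (coeff-*P-shift c ν₀ ν q) ⟩
    (if does (ν′ ≟M ν) then c ℤ.* c′ else ℤ.+ 0) ℤ.+ c ℤ.* coeff q ν
  ≡⟨ distrib (does (ν′ ≟M ν)) ⟩
    c ℤ.* ((if does (ν′ ≟M ν) then c′ else ℤ.+ 0) ℤ.+ coeff q ν)
  ∎
  where
  open ≡-Reasoning
  distrib : ∀ b → (if b then c ℤ.* c′ else ℤ.+ 0) ℤ.+ c ℤ.* coeff q ν ≡ c ℤ.* ((if b then c′ else ℤ.+ 0) ℤ.+ coeff q ν)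
  distrib true  = sym (ℤ.*-distribˡ-+ c c′ (coeff q ν))
  distrib false = trans (ℤ.+-identityˡ _) (cong (c ℤ.*_) (sym (ℤ.+-identityˡ _)))

coeff-*P-∤ : ∀ c ν₀ μ q → (∀ ν → ν₀ *M ν ≢ μ) → coeff (((c , ν₀) ∷ []) *P q) μ ≡ ℤ.+ 0
coeff-*P-∤ c ν₀ μ []              ∤ = refl
coeff-*P-∤ c ν₀ μ ((c′ , ν′) ∷ q) ∤ =
  trans (cong (λ b → (if b then c ℤ.* c′ else ℤ.+ 0) ℤ.+ coeff (((c , ν₀) ∷ []) *P q) μ)
              (dec-false ((ν₀ *M ν′) ≟M μ) (∤ ν′)))
        (trans (ℤ.+-identityˡ _) (coeff-*P-∤ c ν₀ μ q ∤))

coeff-scal : ∀ c p μ → coeff (scal c p) μ ≡ c ℤ.* coeff p μ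
coeff-scal c p μ = coeff-*P-shift c oneM μ p

*P-distribʳ-+P : ∀ p p′ q → (p +P p′) *P q ≡ (p *P q) +P (p′ *P q)
*P-distribʳ-+P p p′ q = List.concatMap-++ _ p p′

-- The coefficient of m^a m̄^b d^c d̄^e in (d̄m̄)^k (d + m)^j.
uvCoeff : ℕ → ℕ → Mono → ℕ
uvCoeff k j (a , b , c , e) = when (does (b ℕ.≟ k) ∧ does (e ℕ.≟ k) ∧ does (a + c ℕ.≟ j)) (binom a c)

uvCoeff-0-0 : ∀ μ → δ oneM μ ≡ uvCoeff 0 0 μ
uvCoeff-0-0 (zero  , suc b , c     , e)     = refl
uvCoeff-0-0 (suc a , suc b , c     , e)     = refl
uvCoeff-0-0 (suc a , zero  , c     , suc e) = refl
uvCoeff-0-0 (zero  , zero  , zero  , suc e) = refl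
uvCoeff-0-0 (zero  , zero  , suc c , suc e) = refl
uvCoeff-0-0 (suc a , zero  , c     , zero)  = refl
uvCoeff-0-0 (zero  , zero  , zero  , zero)  = refl
uvCoeff-0-0 (zero  , zero  , suc c , zero)  = refl

times-d times-m : (Mono → ℕ) → Mono → ℕ
times-d f (a , b , zero  , e) = 0
times-d f (a , b , suc c , e) = f (a , b , c , e)
times-m f (zero  , b , c , e) = 0
times-m f (suc a , b , c , e) = f (a , b , c , e)

coeff-var*P : ∀ q (f : Mono → ℕ) → (∀ ν → coeff q ν ≡ ℤ.+ f ν) →
              ∀ μ → coeff (var d *P q) μ ≡ ℤ.+ times-d f μ × coeff (var m *P q) μ ≡ ℤ.+ times-m f μ
coeff-var*P q f eq μ@(a , b , c , e) = dPart c , mPart a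
  where
  dPart : ∀ c → coeff (var d *P q) (a , b , c , e) ≡ ℤ.+ times-d f (a , b , c , e)
  dPart zero    = coeff-*P-∤ (ℤ.+ 1) (0 , 0 , 1 , 0) _ q (λ ν ())
  dPart (suc c) = trans (coeff-*P-shift (ℤ.+ 1) (0 , 0 , 1 , 0) (a , b , c , e) q) (trans (ℤ.*-identityˡ _) (eq _))
  mPart : ∀ a → coeff (var m *P q) (a , b , c , e) ≡ ℤ.+ times-m f (a , b , c , e)
  mPart zero    = coeff-*P-∤ (ℤ.+ 1) (1 , 0 , 0 , 0) _ q (λ ν ())
  mPart (suc a) = trans (coeff-*P-shift (ℤ.+ 1) (1 , 0 , 0 , 0) (a , b , c , e) q) (trans (ℤ.*-identityˡ _) (eq _))

uvCoeff-pascal : ∀ j μ → times-d (uvCoeff 0 j) μ + times-m (uvCoeff 0 j) μ ≡ uvCoeff 0 (suc j) μ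
uvCoeff-pascal j (zero  , b , zero  , e) =
  sym (trans (cong (λ x → when (does (b ℕ.≟ 0) ∧ x) 1) (Bool.∧-zeroʳ (does (e ℕ.≟ 0))))
             (cong (λ x → when x 1) (Bool.∧-zeroʳ (does (b ℕ.≟ 0)))))
uvCoeff-pascal j (zero  , b , suc c , e) = ℕ.+-identityʳ _
uvCoeff-pascal j (suc a , b , zero  , e) =
  cong (when (does (b ℕ.≟ 0) ∧ does (e ℕ.≟ 0) ∧ does (a + 0 ℕ.≟ j))) (binom-zeroʳ a)
uvCoeff-pascal j (suc a , b , suc c , e) = begin
    when (G (does (suc a + c ℕ.≟ j))) (binom (suc a) c) + when (G (does (a + suc c ℕ.≟ j))) (binom a (suc c))
  ≡⟨ cong (λ i → when (G (does (i ℕ.≟ j))) (binom (suc a) c) + when (G (does (a + suc c ℕ.≟ j))) (binom a (suc c)))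
          (sym (ℕ.+-suc a c)) ⟩
    when (G (does (a + suc c ℕ.≟ j))) (binom (suc a) c) + when (G (does (a + suc c ℕ.≟ j))) (binom a (suc c))
  ≡⟨ when-+ (G (does (a + suc c ℕ.≟ j))) _ _ ⟨
    when (G (does (a + suc c ℕ.≟ j))) (binom (suc a) c + binom a (suc c))
  ≡⟨ cong (when (G (does (a + suc c ℕ.≟ j)))) (ℕ.+-comm (binom (suc a) c) _) ⟩
    when (G (does (a + suc c ℕ.≟ j))) (binom a (suc c) + binom (suc a) c)
  ∎
  where
  open ≡-Reasoning
  G : Bool → Bool
  G x = does (b ℕ.≟ 0) ∧ does (e ℕ.≟ 0) ∧ x

coeff-v^j : ∀ j μ → coeff ((var d +P var m) ^P j) μ ≡ ℤ.+ uvCoeff 0 j μ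
coeff-v^j zero    μ = trans (coeff-α [] μ) (cong ℤ.+_ (uvCoeff-0-0 μ))
coeff-v^j (suc j) μ = begin
    coeff ((var d +P var m) *P X) μ
  ≡⟨ cong (λ p → coeff p μ) (*P-distribʳ-+P (var d) (var m) X) ⟩
    coeff ((var d *P X) ++ (var m *P X)) μ
  ≡⟨ coeff-++ (var d *P X) (var m *P X) μ ⟩
    coeff (var d *P X) μ ℤ.+ coeff (var m *P X) μ
  ≡⟨ cong₂ ℤ._+_ (proj₁ byLetter) (proj₂ byLetter) ⟩
    ℤ.+ (times-d (uvCoeff 0 j) μ + times-m (uvCoeff 0 j) μ)
  ≡⟨ cong ℤ.+_ (uvCoeff-pascal j μ) ⟩
    ℤ.+ uvCoeff 0 (suc j) μ
  ∎
  where
  open ≡-Reasoning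
  X = (var d +P var m) ^P j
  byLetter = coeff-var*P X (uvCoeff 0 j) (coeff-v^j j) μ

u^k≡term : ∀ k → (var d̄ *P var m̄) ^P k ≡ (ℤ.+ 1 , (0 , k , 0 , k)) ∷ []
u^k≡term zero    = refl
u^k≡term (suc k) rewrite u^k≡term k = refl

k+x≟k : ∀ k x → does (k + x ℕ.≟ k) ≡ does (x ℕ.≟ 0)
k+x≟k k x = does-⇔ (mk⇔ (λ eq → ℕ.+-cancelˡ-≡ k x 0 (trans eq (sym (ℕ.+-identityʳ k))))
                        (λ { refl → ℕ.+-identityʳ k }))
                   (k + x ℕ.≟ k) (x ℕ.≟ 0)

coeff-u^kv^j : ∀ k j μ → coeff (((var d̄ *P var m̄) ^P k) *P ((var d +P var m) ^P j)) μ ≡ ℤ.+ uvCoeff k j μ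
coeff-u^kv^j k j (A , B , C , E) rewrite u^k≡term k = byExponents (k ℕ.≤? B) (k ℕ.≤? E)
  where
  X = (var d +P var m) ^P j
  uᵏ = (0 , k , 0 , k)
  outside : ¬ (k ≤ B × k ≤ E) → coeff (((ℤ.+ 1 , uᵏ) ∷ []) *P X) (A , B , C , E) ≡ ℤ.+ uvCoeff k j (A , B , C , E)
  outside k≰ =
    trans (coeff-*P-∤ (ℤ.+ 1) uᵏ (A , B , C , E) X
                      (λ ν eq → k≰ ( below (cong (λ μ → proj₁ (proj₂ μ)) eq)
                                   , below (cong (λ μ → proj₂ (proj₂ (proj₂ μ))) eq) )))
          (cong ℤ.+_ (sym (when-no ((B ℕ.≟ k) ×-dec (E ℕ.≟ k) ×-dec (A + C ℕ.≟ j))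
                                   (λ (B≡k , E≡k , _) → k≰ (ℕ.≤-reflexive (sym B≡k) , ℕ.≤-reflexive (sym E≡k))))))
    where
    below : ∀ {x y} → k + x ≡ y → k ≤ y
    below refl = ℕ.m≤m+n k _
  byExponents : Dec (k ≤ B) → Dec (k ≤ E) →
                coeff (((ℤ.+ 1 , uᵏ) ∷ []) *P X) (A , B , C , E) ≡ ℤ.+ uvCoeff k j (A , B , C , E)
  byExponents (yes k≤B) (yes k≤E) with ℕ.m≤n⇒∃[o]m+o≡n k≤B | ℕ.m≤n⇒∃[o]m+o≡n k≤E
  ... | B′ , refl | E′ , refl = begin
      coeff (((ℤ.+ 1 , uᵏ) ∷ []) *P X) (uᵏ *M (A , B′ , C , E′))
    ≡⟨ coeff-*P-shift (ℤ.+ 1) uᵏ (A , B′ , C , E′) X ⟩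
      ℤ.+ 1 ℤ.* coeff X (A , B′ , C , E′)
    ≡⟨ trans (ℤ.*-identityˡ _) (coeff-v^j j (A , B′ , C , E′)) ⟩
      ℤ.+ uvCoeff 0 j (A , B′ , C , E′)
    ≡⟨ cong₂ (λ x y → ℤ.+ when (x ∧ y ∧ does (A + C ℕ.≟ j)) (binom A C)) (k+x≟k k B′) (k+x≟k k E′) ⟨
      ℤ.+ uvCoeff k j (A , k + B′ , C , k + E′)
    ∎
    where open ≡-Reasoning
  byExponents (no k≰B) _        = outside (λ (k≤B , _) → k≰B k≤B)
  byExponents (yes _)   (no k≰E) = outside (λ (_ , k≤E) → k≰E k≤E)

coeff-rhs : ∀ n c μ → coeff (rhs n c) μ ≡ ℤ.+ ∑ (range1 (n / 2)) (λ k → c k * uvCoeff k (n ∸ (k + k)) μ)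
coeff-rhs n c μ = coeff-sumP (range1 (n / 2)) term (λ k → c k * uvCoeff k (n ∸ (k + k)) μ) μ (λ k →
  trans (coeff-scal (ℤ.+ c k) (uv k) μ)
        (trans (cong (ℤ.+ c k ℤ.*_) (coeff-u^kv^j k (n ∸ (k + k)) μ)) (sym (ℤ.pos-* (c k) _))))
  where
  uv : ℕ → Poly
  uv k = ((var d̄ *P var m̄) ^P k) *P ((var d +P var m) ^P (n ∸ (k + k)))
  term : ℕ → Poly
  term k = scal (ℤ.+ c k) (uv k)

≤half⇒double≤ : ∀ k n → k ≤ n / 2 → k + k ≤ n
≤half⇒double≤ k n k≤n/2 = ℕ.≤-trans (ℕ.≤-reflexive (twice k)) (ℕ.≤-trans (ℕ.*-monoˡ-≤ 2 k≤n/2) (DivMod.m/n*n≤m n 2))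
  where
  twice : ∀ k → k + k ≡ k * 2
  twice = solve-∀

double≤⇒≤half : ∀ k n → k + k ≤ n → k ≤ n / 2
double≤⇒≤half k n 2k≤n =
  ℕ.≤-trans (ℕ.≤-reflexive (sym (DivMod.m*n/n≡m k 2))) (DivMod./-monoˡ-≤ 2 (ℕ.≤-trans (ℕ.≤-reflexive (twice k)) 2k≤n))
  where
  twice : ∀ k → k * 2 ≡ k + k
  twice = solve-∀

degree-balanced : ∀ A k C → degree (A , k , C , k) ≡ (A + C) + (k + k)
degree-balanced = regroup
  where
  regroup : ∀ A k C → A + k + C + k ≡ (A + C) + (k + k)
  regroup = solve-∀

admissible⇔ : ∀ n A k C E → k + k ≤ n → (E ≡ k × A + C ≡ n ∸ (k + k)) ⇔ Admissible n (A , k , C , E)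
admissible⇔ n A k C E 2k≤n = mk⇔
  (λ { (refl , A+C≡) → refl , trans (degree-balanced A k C) (trans (cong (_+ (k + k)) A+C≡) (ℕ.m∸n+n≡m 2k≤n)) })
  (λ { (refl , deg)  → refl , trans (sym (ℕ.m+n∸n≡m (A + C) (k + k)))
                                    (cong (_∸ (k + k)) (trans (sym (degree-balanced A k C)) deg)) })

∑-uvCoeff≡closedCoeff : ∀ n μ → ∑ (range1 (n / 2)) (λ k → γ k (n ∸ (k + k)) * uvCoeff k (n ∸ (k + k)) μ)
                                ≡ closedCoeff n μ
∑-uvCoeff≡closedCoeff n μ@(A , B , C , E) = trans (∑-cong (range1 (n / 2)) guardB) (pick B)
  where
  term : ℕ → ℕ
  term k = γ k (n ∸ (k + k)) * when (does (E ℕ.≟ k) ∧ does (A + C ℕ.≟ n ∸ (k + k))) (binom A C)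
  guardB : ∀ k → γ k (n ∸ (k + k)) * uvCoeff k (n ∸ (k + k)) μ ≡ when (does (B ℕ.≟ k)) (term k)
  guardB k = trans (cong (γ k (n ∸ (k + k)) *_) (when-∧ (does (B ℕ.≟ k)) _ (binom A C)))
                   (*-when (γ k (n ∸ (k + k))) (does (B ℕ.≟ k)) _)
  pick : ∀ B → ∑ (range1 (n / 2)) (λ k → when (does (B ℕ.≟ k)) (term k)) ≡ closedCoeff n (A , B , C , E)
  pick zero = trans (∑-pick-∉ term (range1 (n / 2)) (λ k∈ → ℕ.<⇒≢ (All.lookup (range1-positive (n / 2)) k∈)))
                    (sym (when-zero (does (admissible? n (A , 0 , C , E)))))
  pick (suc K) with suc K ℕ.≤? n / 2
  ... | yes K<n/2 =
    trans (∑-pick-∈ term (∈-range1 (s≤s z≤n) K<n/2) (unique-range1 (n / 2)))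
          (trans (*-when (γ (suc K) (n ∸ (suc K + suc K))) _ (binom A C))
                 (when-⇔ ((E ℕ.≟ suc K) ×-dec (A + C ℕ.≟ n ∸ (suc K + suc K))) (admissible? n (A , suc K , C , E))
                         (admissible⇔ n A (suc K) C E (≤half⇒double≤ (suc K) n K<n/2))
                         (λ (_ , A+C≡) → cong (λ i → γ (suc K) i * binom A C) (sym A+C≡))))
  ... | no  K≮n/2 =
    trans (∑-pick-∉ term (range1 (n / 2)) (λ { k∈ refl → K≮n/2 (ℕ.≤-pred (All.lookup (range1-< (n / 2)) k∈)) }))
          (sym (when-no (admissible? n (A , suc K , C , E)) (λ { (refl , deg) →
             K≮n/2 (double≤⇒≤half (suc K) n
                     (ℕ.≤-trans (ℕ.m≤n+m (suc K + suc K) (A + C))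
                                (ℕ.≤-reflexive (trans (sym (degree-balanced A (suc K) C)) deg)))) })))

mainTheorem18 : (n : ℕ) → n ≥ 2 → Σ (ℕ → ℕ) (λ c → lhs n ≈P rhs n c)
mainTheorem18 (suc zero) (s≤s ())
mainTheorem18 (suc (suc ℓ)) _ = c , λ μ → begin
    coeff (lhs n) μ                                                  ≡⟨ coeff-lhs ℓ μ ⟩
    ℤ.+ lhsCount (suc ℓ) μ                                           ≡⟨ cong ℤ.+_ (lhsCount≡closedCoeff ℓ μ) ⟩
    ℤ.+ closedCoeff n μ                                              ≡⟨ cong ℤ.+_ (∑-uvCoeff≡closedCoeff n μ) ⟨
    ℤ.+ ∑ (range1 (n / 2)) (λ k → c k * uvCoeff k (n ∸ (k + k)) μ)  ≡⟨ coeff-rhs n c μ ⟨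
    coeff (rhs n c) μ                                                ∎
  where
  open ≡-Reasoning
  n = suc (suc ℓ)
  c : ℕ → ℕ
  c k = γ k (n ∸ (k + k))
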